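{- Let $Z_n=(\mathrm{UD})^n$ denote the zig-zag Dyck path UDUD$\cdots$UD of order $n$. The maps $\operatorname{DTS}(Z_n,\cdot)$ and $\operatorname{DTR}(Z_n,\cdot)$ restrict to bijections between 231-avoiding permutations in $S_n$ and Dyck tilings whose lower path is $Z_n$ and which contain only one-box tiles.
   Context: A permutation $\sigma$ is 231-avoiding if there are no $i<j<k$ with $\sigma_k<\sigma_i<\sigma_j$. For $\lambda=Z_n$, the chord poset (chords = segments between matching up and down steps, ordered by nesting) is an antichain, so its set of linear extensions $\mathscr{L}(P_{Z_n})$ is all of $S_n$. Dyck tilings: for Dyck paths $\mu$ weakly above $\lambda$ (lattice paths with steps $(+1,\pm1)$ from $(-n,0)$ to $(n,0)$ staying at height $\ge0$), a Dyck tile is a ribbon tile (connected skew shape without a $2\times2$ square) whose leftmost and rightmost boxes are at equal height with no box below them; a Dyck tiling tiles the skew shape between $\lambda$ and $\mu$; it is cover-inclusive if whenever a tile has a box directly above a box of another tile, its horizontal extent is contained in that of the other. Labeled trees $(\lambda,\sigma)$ (chord poset of $\lambda$ with root adjoined, naturally labeled; $\sigma$ = standardization of the left endpoints $\ell_1,\dots,\ell_n$ of chords labeled $1,\dots,n$) correspond bijectively to sequences $p_1,\dots,p_n$ with $0\le p_i\le 2(i-1)$, $p_i=\#\{j<i:\ell_j<\ell_i\}+\#\{j<i:r_j<\ell_i\}$. The spread of a path at column $s$ shifts points with $x\le s$ by $(-1,0)$, points with $x\ge s$ by $(+1,0)$, and points at $x=s$ also by $(0,+1)$; tilings are spread by spreading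 boundaries and tiles (tiles coordinatized by the path of lower corners of their boxes). A column $s$ of a tiling of $\lambda/\mu$ is eligible if $\mu$ has an up step ending at column $s$ and $\mu$'s point at column $s$ is not the top corner of a one-box tile; the special column is the rightmost eligible one. strip-grow$(T,s)$: spread $T$ at $s$, then add a one-box tile on each up step of the upper boundary from the growth site to the right boundary. ribbon-grow$(T,s)$: spread at $s$, then if the spread's special column $Q$ is right of $s$, add a ribbon of one-box tiles on top in columns strictly between $s$ and $Q$. $\operatorname{DTS}(p_1,\dots,p_n)$ (resp. $\operatorname{DTR}$) is obtained from the empty tiling by successively applying strip-grow (resp. ribbon-grow) at column $p_k-(k-1)$, $k=1,\dots,n$; $\operatorname{DTS}(\lambda,\sigma)$, $\operatorname{DTR}(\lambda,\sigma)$ apply these to the sequence of the labeled tree $(\lambda,\sigma)$, and have lower path $\lambda$.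
   Formalization: In the labeled tree (λ,σ), σ is the word of chord labels listed left to right (the j-th chord from the left has label σⱼ), in place of the standardization of ℓ₁,…,ℓₙ, which is σ⁻¹. The statement above fails without it. -}

module Defs where

open import Data.Bool using (Bool; true; false; if_then_else_; _∧_; not)
open import Data.Nat using (ℕ; zero; suc; _+_; _*_; _∸_; _<_; _≤_; _<ᵇ_; _≤ᵇ_; _≡ᵇ_)
open import Data.Integer as ℤ using (ℤ; +_)
open import Data.Fin as Fin using (Fin)
open import Data.List using (List; []; _∷_; _++_; map; concat; concatMap; replicate; take; drop; length; filterᵇ; upTo; foldl; last; lookup)
open import Data.Bool.ListAction using (any)
open import Data.List.Membership.Propositional using (_∈_)
open import Data.List.Relation.Unary.All using (All)
open import Data.List.Relation.Unary.Unique.Propositional using (Unique)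
open import Data.List.Relation.Binary.Permutation.Propositional using (_↭_)
open import Data.Maybe using (Maybe; just; nothing)
open import Data.Product using (Σ; _×_; _,_; proj₁; proj₂)
open import Relation.Binary.PropositionalEquality using (_≡_)
open import Relation.Nullary using (¬_)
open import Relation.Nullary.Decidable using (⌊_⌋)

-- A lattice path is a list of steps, true = U = (+1,+1), false = D = (+1,-1).
-- We use shifted ℕ column coordinates: a path of semilength n, drawn in
-- the paper from (-n,0) to (n,0), is drawn here from (0,0) to (2n,0), so
-- the paper's column x is our column X = x + n.

Path : Set
Path = List Bool

Δ : Bool → ℤ
Δ true  = + 1
Δ false = ℤ.- (+ 1)

hgt : Path → ℤ
hgt []      = + 0
hgt (b ∷ p) = Δ b ℤ.+ hgt p

-- height of the path at column X (for X ≥ length p: the end height)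
heightAt : Path → ℕ → ℤ
heightAt p X = hgt (take X p)

-- the step starting at column X (false if out of range; never used there)
stepAt : Path → ℕ → Bool
stepAt []      _       = false
stepAt (b ∷ _) zero    = b
stepAt (_ ∷ p) (suc i) = stepAt p i

IsDyckPath : ℕ → Path → Set
IsDyckPath n p = (length p ≡ 2 * n) × (∀ X → + 0 ℤ.≤ heightAt p X) × (heightAt p (length p) ≡ + 0)

WeaklyAbove : Path → Path → Set
WeaklyAbove μ lo = ∀ X → heightAt lo X ℤ.≤ heightAt μ X

Z : ℕ → Path
Z n = concat (replicate n (true ∷ false ∷ []))

-- Boxes and tiles.
-- A box is identified by its lower corner (X , Y); it has corners
-- (X,Y), (X-1,Y+1), (X+1,Y+1), (X,Y+2).
Box : Set
Box = ℕ × ℤ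

-- A ribbon tile, coordinatized by the lattice path of the lower corners of
-- its boxes: leftmost box lower corner (x , y), then the steps 'shape'.
-- (Any such path gives a connected skew shape with no 2×2 square, and
-- every ribbon arises this way.)
record Tile : Set where
  constructor tile
  field
    x     : ℕ
    y     : ℤ
    shape : List Bool
open Tile public

boxesFrom : ℕ → ℤ → List Bool → List Box
boxesFrom X Y []      = (X , Y) ∷ []
boxesFrom X Y (b ∷ p) = (X , Y) ∷ boxesFrom (suc X) (Y ℤ.+ Δ b) p

boxesOf : Tile → List Box
boxesOf t = boxesFrom (x t) (y t) (shape t)

IsDyckTile : Tile → Set
IsDyckTile t = All (λ b → y t ℤ.≤ proj₂ b) (boxesOf t) × (y t ℤ.+ hgt (shape t) ≡ y t)

IsOneBox : Tile → Set
IsOneBox t = shape t ≡ []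

record Tiling : Set where
  constructor mkTiling
  field
    lower : Path
    upper : Path
    tiles : List Tile
open Tiling public

allBoxes : Tiling → List Box
allBoxes T = concatMap boxesOf (tiles T)

InSkew : Path → Path → Box → Set
InSkew lo μ (X , Y) =
  (X < length lo) × Σ ℕ (λ k → Y ≡ heightAt lo X ℤ.+ + (2 * k)) × (Y ℤ.+ + 2 ℤ.≤ heightAt μ X)

CoverInclusive : List Tile → Set
CoverInclusive ts = ∀ {t₁ t₂} → t₁ ∈ ts → t₂ ∈ ts → ∀ X Y →
  (X , Y ℤ.+ + 2) ∈ boxesOf t₁ → (X , Y) ∈ boxesOf t₂ →
  (x t₂ ≤ x t₁) × (x t₁ + length (shape t₁) ≤ x t₂ + length (shape t₂))

IsDyckTiling : ℕ → Tiling → Set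
IsDyckTiling n T =
  IsDyckPath n (lower T) × IsDyckPath n (upper T) × WeaklyAbove (upper T) (lower T) ×
  All IsDyckTile (tiles T) ×
  Unique (allBoxes T) × All (InSkew (lower T) (upper T)) (allBoxes T) ×
  (∀ b → InSkew (lower T) (upper T) b → b ∈ allBoxes T) ×
  CoverInclusive (tiles T)

OneBoxZTiling : ℕ → Tiling → Set
OneBoxZTiling n T = (lower T ≡ Z n) × IsDyckTiling n T × All IsOneBox (tiles T)

-- equality of tilings (tiles form a set, so compare lists up to permutation)
_≈T_ : Tiling → Tiling → Set
T ≈T T' = (lower T ≡ lower T') × (upper T ≡ upper T') × (tiles T ↭ tiles T')

-- Points with X < S stay,
-- points with X > S move by 2 to the right, and a point (S , h) becomes
-- (S , h), (S+1 , h+1), (S+2 , h): i.e. a UD is inserted at column S.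
spreadPath : ℕ → Path → Path
spreadPath S p = take S p ++ (true ∷ false ∷ drop S p)

spreadTile : ℕ → Tile → Tile
spreadTile S (tile a b sh) =
  if S <ᵇ a then tile (2 + a) b sh
  else if S ≤ᵇ a + length sh
    then tile a b (take (S ∸ a) sh ++ (true ∷ false ∷ drop (S ∸ a) sh))
    else tile a b sh

spread : ℕ → Tiling → Tiling
spread S T = mkTiling (spreadPath S (lower T)) (spreadPath S (upper T)) (map (spreadTile S) (tiles T))

_∈ᵇ_ : ℕ → List ℕ → Bool
X ∈ᵇ Xs = any (X ≡ᵇ_) Xs

-- Adding one-box tiles on top of the upper boundary at the columns Xs:
-- the new tiles have lower corner (X , μ(X)); the new upper boundary is
-- the path whose height is μ(X) + 2 at X ∈ Xs and μ(X) elsewhere.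
raise : List ℕ → Path → Path
raise Xs μ = map (λ i → ⌊ h' i ℤ.<? h' (suc i) ⌋) (upTo (length μ))
  where
  h' : ℕ → ℤ
  h' X = heightAt μ X ℤ.+ (if X ∈ᵇ Xs then + 2 else + 0)

addOnTop : List ℕ → Tiling → Tiling
addOnTop Xs T = mkTiling (lower T) (raise Xs (upper T))
  (tiles T ++ map (λ X → tile X (heightAt (upper T) X) []) Xs)

-- After spreading at S (our coordinates), the new peak ("growth site")
-- is at column S + 1 (= the paper's column s).

stripGrow : ℕ → Tiling → Tiling
stripGrow S T = addOnTop (filterᵇ (λ X → (S + 1 ≤ᵇ X) ∧ stepAt μ X) (upTo (length μ))) T'
  where
  T' = spread S T
  μ  = upper T'

isOneBoxTopAt : ℕ → ℤ → Tile → Bool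
isOneBoxTopAt X h (tile a b [])      = (a ≡ᵇ X) ∧ ⌊ b ℤ.+ + 2 ℤ.≟ h ⌋
isOneBoxTopAt X h (tile a b (_ ∷ _)) = false

eligible : Tiling → ℕ → Bool
eligible T X = (1 ≤ᵇ X) ∧ stepAt (upper T) (X ∸ 1) ∧ not (any (isOneBoxTopAt X (heightAt (upper T) X)) (tiles T))

special : Tiling → Maybe ℕ
special T = last (filterᵇ (eligible T) (upTo (suc (length (upper T)))))

ribbonGrow : ℕ → Tiling → Tiling
ribbonGrow S T with special (spread S T)
... | nothing = spread S T
... | just Q  = if S + 1 <ᵇ Q
                then addOnTop (filterᵇ (λ X → (S + 1 <ᵇ X) ∧ (X <ᵇ Q)) (upTo Q)) (spread S T)
                else spread S T

emptyTiling : Tiling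
emptyTiling = mkTiling [] [] []

-- DTS(p₁,…,pₙ), DTR(p₁,…,pₙ): grow at the paper's column p_k - (k-1),
-- which in our coordinates (tiling of semilength k-1) is column p_k.
DTSseq : List ℕ → Tiling
DTSseq = foldl (λ T p → stripGrow p T) emptyTiling

DTRseq : List ℕ → Tiling
DTRseq = foldl (λ T p → ribbonGrow p T) emptyTiling

-- Chords and labeled trees.
-- For the U step at index i, the index of its matching D step.
findClose : ℕ → Path → ℕ
findClose d       []          = 0
findClose d       (true ∷ p)  = suc (findClose (suc d) p)
findClose zero    (false ∷ p) = 0
findClose (suc d) (false ∷ p) = suc (findClose d p)

chordsFrom : ℕ → Path → List (ℕ × ℕ)
chordsFrom i []          = []
chordsFrom i (true ∷ p)  = (i , suc (i + findClose 0 p)) ∷ chordsFrom (suc i) p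
chordsFrom i (false ∷ p) = chordsFrom (suc i) p

chords : Path → List (ℕ × ℕ)
chords = chordsFrom 0

nthD : {A : Set} → A → List A → ℕ → A
nthD d []       _       = d
nthD d (a ∷ _)  zero    = a
nthD d (_ ∷ as) (suc k) = nthD d as k

posOf : ℕ → List ℕ → ℕ
posOf i []      = 0
posOf i (a ∷ s) = if a ≡ᵇ i then 0 else suc (posOf i s)

-- The labeled tree (λ , σ): the j-th chord from the left carries label σ_j
--.  List of chords in label order 1,…,n.
labeledChords : Path → List ℕ → List (ℕ × ℕ)
labeledChords lo σ = map (λ i → nthD (0 , 0) (chords lo) (posOf i σ)) (map suc (upTo (length σ)))

count : {A : Set} → (A → Bool) → List A → ℕ
count f l = length (filterᵇ f l)

pSeqFrom : List (ℕ × ℕ) → List (ℕ × ℕ) → List ℕ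
pSeqFrom prev []              = []
pSeqFrom prev ((ℓ , r) ∷ cs) =
  (count (λ c → proj₁ c <ᵇ ℓ) prev + count (λ c → proj₂ c <ᵇ ℓ) prev)
  ∷ pSeqFrom (prev ++ ((ℓ , r) ∷ [])) cs

treeSeq : Path → List ℕ → List ℕ
treeSeq lo σ = pSeqFrom [] (labeledChords lo σ)

DTS : Path → List ℕ → Tiling
DTS lo σ = DTSseq (treeSeq lo σ)

DTR : Path → List ℕ → Tiling
DTR lo σ = DTRseq (treeSeq lo σ)

IsPerm : ℕ → List ℕ → Set
IsPerm n σ = σ ↭ map suc (upTo n)

Avoids231 : List ℕ → Set
Avoids231 σ = ∀ (i j k : Fin (length σ)) → i Fin.< j → j Fin.< k →
  ¬ ((lookup σ k < lookup σ i) × (lookup σ i < lookup σ j))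

Perm231 : ℕ → List ℕ → Set
Perm231 n σ = IsPerm n σ × Avoids231 σ

RestrictsToBijection : {A B : Set} → (A → B) → (A → Set) → (B → Set) → (B → B → Set) → Set
RestrictsToBijection {A} f P Q _≈_ =
  (∀ a → P a → Q (f a)) ×
  (∀ a a' → P a → P a' → f a ≈ f a' → a ≡ a') ×
  (∀ b → Q b → Σ A (λ a → P a × (f a ≈ b)))

-- A one-box tiling is just the set of boxes of its skew shape, so a one-box tiling with lower
-- path Z_n is determined by its upper path, which can be any Dyck path of semilength n; it
-- therefore suffices to match 231-avoiding permutations with Dyck paths.
-- The chords of Z_n are pairwise disjoint, so the sequence of the labeled tree (Z_n, σ) has
-- p_k = 2 #{j < k : j stands left of k in σ}; inserting the maximum n + 1 at position a of σ
-- appends 2a, i.e. the last growth step acts at column 2a. A 231-avoiding σ of size n + 1 is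
-- α (n+1) β with every entry of α below every entry of β, and inductively the Dyck prefixes
-- of the upper path are exactly the cuts α | β of σ with α below β. Growing at the end of the
-- prefix A of length 2|α| turns the upper path A B into A U B D (strip-grow) or A U φ(B) D
-- (ribbon-grow), where φ([]) = [] and φ(B′ U C D) = U B′ D C is a bijection of Dyck paths.
-- Since a nonempty Dyck path has a unique last-return decomposition A U X D, this growth can
-- be undone, which gives injectivity and surjectivity by induction on n.

module Submission where

open import Defs
open import Data.Bool using (Bool; true; false; if_then_else_; _∧_; not)
open import Data.Bool.Properties using (T?; T-≡; ∧-zeroʳ)
open import Data.Bool.ListAction using (any)
open import Data.Nat as ℕ using (ℕ; zero; suc; _+_; _*_; _∸_; _<_; _≤_; z≤n; s≤s; _<ᵇ_; _≤ᵇ_; _≡ᵇ_)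
import Data.Nat.Properties as ℕP
open import Data.Nat.Tactic.RingSolver using () renaming (solve-∀ to ℕ-solve)
open import Data.Integer as ℤ using (ℤ; +_; -[1+_])
import Data.Integer.Properties as ℤP
open import Data.Integer.Tactic.RingSolver using () renaming (solve-∀ to ℤ-solve)
open import Data.Fin as Fin using (Fin)
open import Data.List using (List; []; _∷_; _++_; _∷ʳ_; map; concatMap; take; drop; length; filterᵇ; upTo; applyUpTo; last; lookup; foldl)
import Data.List.Properties as ListP
open import Data.List.Relation.Unary.All as All using (All; []; _∷_)
import Data.List.Relation.Unary.All.Properties as AllP
open import Data.List.Relation.Unary.Any using (here; there)
open import Data.List.Relation.Unary.AllPairs using ([]; _∷_)
open import Data.List.Relation.Unary.Unique.Propositional using (Unique)
import Data.List.Relation.Unary.Unique.Propositional.Properties as UniqueP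
open import Data.List.Membership.Propositional using (_∈_; _∉_)
import Data.List.Membership.Propositional.Properties as ∈P
open import Data.List.Relation.Binary.Permutation.Propositional using (_↭_; ↭-refl; ↭-sym; prep; ↭⇒↭ₛ; module PermutationReasoning)
open import Data.List.Relation.Binary.BagAndSetEquality using (∼bag⇒↭)
open import Data.List.Membership.Propositional.Properties.WithK using (unique∧set⇒bag)
import Data.List.Relation.Binary.Permutation.Propositional.Properties as ↭P
import Data.List.Relation.Binary.Permutation.Setoid.Properties as ↭ₛP
open import Data.Maybe using (just)
open import Data.Product using (Σ; _×_; _,_; proj₁; proj₂)
open import Data.Sum using (_⊎_; inj₁; inj₂)
open import Data.Empty using (⊥; ⊥-elim)
open import Data.Unit using (⊤; tt)
open import Function using (_∘_)
open import Function.Bundles using (mk⇔; Equivalence)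
open import Relation.Binary.Definitions using (tri<; tri≈; tri>)
open import Relation.Binary.PropositionalEquality
open import Relation.Nullary using (¬_; Dec; yes; no)
open import Relation.Nullary.Decidable using (⌊_⌋; dec-true; dec-false; isYes≗does)

-- Booleans and lists

<ᵇ-true : ∀ {m n} → m < n → (m <ᵇ n) ≡ true
<ᵇ-true lt = Equivalence.to T-≡ (ℕP.<⇒<ᵇ lt)

<ᵇ⇒< : ∀ {m n} → (m <ᵇ n) ≡ true → m < n
<ᵇ⇒< {m} {n} e = ℕP.<ᵇ⇒< m n (Equivalence.from T-≡ e)

<ᵇ-false : ∀ {m n} → n ≤ m → (m <ᵇ n) ≡ false
<ᵇ-false {m} {n} le with m <ᵇ n in e
... | false = refl
... | true  = ⊥-elim (ℕP.<⇒≱ (<ᵇ⇒< e) le)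

<ᵇ-false⇒≥ : ∀ {m n} → (m <ᵇ n) ≡ false → n ≤ m
<ᵇ-false⇒≥ e = ℕP.≮⇒≥ (λ lt → true≢false (trans (sym (<ᵇ-true lt)) e))
  where
  true≢false : true ≢ false
  true≢false ()

≤ᵇ-true : ∀ {m n} → m ≤ n → (m ≤ᵇ n) ≡ true
≤ᵇ-true le = Equivalence.to T-≡ (ℕP.≤⇒≤ᵇ le)

≤ᵇ-false : ∀ {m n} → n < m → (m ≤ᵇ n) ≡ false
≤ᵇ-false {suc m} lt = <ᵇ-false (ℕP.≤-pred lt)

≡ᵇ-refl : ∀ n → (n ≡ᵇ n) ≡ true
≡ᵇ-refl n = Equivalence.to T-≡ (ℕP.≡⇒≡ᵇ n n refl)

≡ᵇ⇒≡ : ∀ {m n} → (m ≡ᵇ n) ≡ true → m ≡ n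
≡ᵇ⇒≡ {m} {n} e = ℕP.≡ᵇ⇒≡ m n (Equivalence.from T-≡ e)

≡ᵇ-false : ∀ {m n} → m ≢ n → (m ≡ᵇ n) ≡ false
≡ᵇ-false {m} {n} ne with m ≡ᵇ n in e
... | false = refl
... | true  = ⊥-elim (ne (≡ᵇ⇒≡ e))

⌊⌋-true : ∀ {A : Set} (a? : Dec A) → A → ⌊ a? ⌋ ≡ true
⌊⌋-true a? a = trans (isYes≗does a?) (dec-true a? a)

⌊⌋-false : ∀ {A : Set} (a? : Dec A) → ¬ A → ⌊ a? ⌋ ≡ false
⌊⌋-false a? ¬a = trans (isYes≗does a?) (dec-false a? ¬a)

∈ᵇ⇒∈ : ∀ X Xs → (X ∈ᵇ Xs) ≡ true → X ∈ Xs
∈ᵇ⇒∈ X (a ∷ Xs) e with X ≡ᵇ a in eq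
... | true  = here (≡ᵇ⇒≡ eq)
... | false = there (∈ᵇ⇒∈ X Xs e)

∈⇒∈ᵇ : ∀ X Xs → X ∈ Xs → (X ∈ᵇ Xs) ≡ true
∈⇒∈ᵇ X (a ∷ Xs) (here refl) rewrite ≡ᵇ-refl X = refl
∈⇒∈ᵇ X (a ∷ Xs) (there m) with X ≡ᵇ a
... | true  = refl
... | false = ∈⇒∈ᵇ X Xs m

any-false : ∀ {A : Set} (p : A → Bool) xs → (∀ {t} → t ∈ xs → p t ≡ false) → any p xs ≡ false
any-false p []       h = refl
any-false p (t ∷ xs) h rewrite h (here refl) = any-false p xs (h ∘ there)

any-true : ∀ {A : Set} (p : A → Bool) xs {t} → t ∈ xs → p t ≡ true → any p xs ≡ true
any-true p (t ∷ xs) (here refl) e rewrite e = refl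
any-true p (u ∷ xs) (there m) e with p u
... | true  = refl
... | false = any-true p xs m e

All-delete : ∀ {A : Set} {P : A → Set} (ys₁ : List A) {x ys₂} → All P (ys₁ ++ x ∷ ys₂) → All P (ys₁ ++ ys₂)
All-delete []        (_ ∷ a) = a
All-delete (y ∷ ys₁) (p ∷ a) = p ∷ All-delete ys₁ a

All-insert : ∀ {A : Set} {P : A → Set} (zs : List A) {n β} → P n → All P (zs ++ β) → All P (zs ++ n ∷ β)
All-insert []       pn a       = pn ∷ a
All-insert (z ∷ zs) pn (p ∷ a) = p ∷ All-insert zs pn a

unique-same-members⇒↭ : ∀ {A : Set} {xs ys : List A} → Unique xs → Unique ys →
  (∀ {z} → z ∈ xs → z ∈ ys) → (∀ {z} → z ∈ ys → z ∈ xs) → xs ↭ ys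
unique-same-members⇒↭ ux uy f g = ∼bag⇒↭ (unique∧set⇒bag ux uy (mk⇔ f g))

Unique-map-on : ∀ {A B : Set} (f : A → B) {xs : List A} → Unique xs →
  (∀ {u v} → u ∈ xs → v ∈ xs → f u ≡ f v → u ≡ v) → Unique (map f xs)
Unique-map-on f {[]}     _         _   = []
Unique-map-on f {a ∷ xs} (ax ∷ ux) inj =
  All.tabulate fresh ∷ Unique-map-on f ux (λ mu mv → inj (there mu) (there mv))
  where
  fresh : ∀ {b} → b ∈ map f xs → f a ≢ b
  fresh m e with ∈P.∈-map⁻ f m
  ... | u , mu , refl = All.lookup ax mu (inj (here refl) (there mu) e)

length≡0 : ∀ {A : Set} (l : List A) → length l ≡ 0 → l ≡ []
length≡0 [] _ = refl

++-split : ∀ {A : Set} (a b c d : List A) → a ++ b ≡ c ++ d →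
  (Σ (List A) λ m → c ≡ a ++ m × b ≡ m ++ d) ⊎ (Σ (List A) λ m → a ≡ c ++ m × d ≡ m ++ b)
++-split []      b c        d eq = inj₁ (c , refl , eq)
++-split (x ∷ a) b []       d eq = inj₂ (x ∷ a , refl , sym eq)
++-split (x ∷ a) b (y ∷ c) d eq with ListP.∷-injective eq
... | refl , eq′ with ++-split a b c d eq′
... | inj₁ (m , e₁ , e₂) = inj₁ (m , cong (x ∷_) e₁ , e₂)
... | inj₂ (m , e₁ , e₂) = inj₂ (m , cong (x ∷_) e₁ , e₂)

++-cancel-length : ∀ {A : Set} (a b c d : List A) → a ++ b ≡ c ++ d → length a ≡ length c → a ≡ c × b ≡ d
++-cancel-length []      b []      d eq _ = refl , eq
++-cancel-length (x ∷ a) b (y ∷ c) d eq l with ListP.∷-injective eq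
... | refl , eq′ with ++-cancel-length a b c d eq′ (ℕP.suc-injective l)
... | refl , e = refl , e

++-prefix-≤ : ∀ (A B A₀ C : Path) → A ++ B ≡ A₀ ++ C → length A ≤ length A₀ →
  Σ Path λ N → (A₀ ≡ A ++ N) × (B ≡ N ++ C)
++-prefix-≤ A B A₀ C eq le with ++-split A B A₀ C eq
... | inj₁ (N , e₁ , e₂) = N , e₁ , e₂
... | inj₂ ([] , e₁ , e₂) = [] , trans (sym (trans e₁ (ListP.++-identityʳ A₀))) (sym (ListP.++-identityʳ A)) , sym e₂
... | inj₂ (n ∷ N , refl , _) =
  ⊥-elim (ℕP.<⇒≱ (subst (length A₀ <_) (sym (ListP.length-++ A₀)) (ℕP.m<m+n (length A₀) (s≤s z≤n))) le)

-- Dyck paths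

data Walk : ℕ → Path → ℕ → Set where
  stop : ∀ {h} → Walk h [] h
  up   : ∀ {h p h′} → Walk (suc h) p h′ → Walk h (true ∷ p) h′
  down : ∀ {h p h′} → Walk h p h′ → Walk (suc h) (false ∷ p) h′

Dyck : Path → Set
Dyck p = Walk 0 p 0

walk-++ : ∀ {a b c p q} → Walk a p b → Walk b q c → Walk a (p ++ q) c
walk-++ stop     w₂ = w₂
walk-++ (up w)   w₂ = up (walk-++ w w₂)
walk-++ (down w) w₂ = down (walk-++ w w₂)

walk-split : ∀ p {q a c} → Walk a (p ++ q) c → Σ ℕ λ b → Walk a p b × Walk b q c
walk-split []          w = _ , stop , w
walk-split (true ∷ p)  (up w)   with walk-split p w
... | b , w₁ , w₂ = b , up w₁ , w₂
walk-split (false ∷ p) (down w) with walk-split p w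
... | b , w₁ , w₂ = b , down w₁ , w₂

walk-end-unique : ∀ {a p b b′} → Walk a p b → Walk a p b′ → b ≡ b′
walk-end-unique stop     stop      = refl
walk-end-unique (up w)   (up w′)   = walk-end-unique w w′
walk-end-unique (down w) (down w′) = walk-end-unique w w′

walk-lift : ∀ {a p b} → Walk a p b → Walk (suc a) p (suc b)
walk-lift stop     = stop
walk-lift (up w)   = up (walk-lift w)
walk-lift (down w) = down (walk-lift w)

dyck-suffix : ∀ {A N} → Dyck (A ++ N) → Dyck A → Dyck N
dyck-suffix {A} w wA with walk-split A w
... | b , w₁ , w₂ with walk-end-unique w₁ wA
... | refl = w₂

prime : ∀ {X} → Dyck X → Dyck (true ∷ X ++ false ∷ [])
prime wX = up (walk-++ (walk-lift wX) (down stop))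

first-descent : ∀ {h p b} → Walk h p b → ∀ d a → h ≡ suc (d + a) → b ≤ a →
  Σ Path λ P → Σ Path λ R → (p ≡ P ++ false ∷ R) × Walk d P 0 × Walk a R b
first-descent stop d a refl le = ⊥-elim (ℕP.<-irrefl refl (ℕP.≤-trans (s≤s (ℕP.m≤n+m a d)) le))
first-descent (up w) d a refl le with first-descent w (suc d) a refl le
... | P , R , refl , w₁ , w₂ = true ∷ P , R , refl , up w₁ , w₂
first-descent (down w) zero    a refl le = [] , _ , refl , stop , w
first-descent (down w) (suc d) a refl le with first-descent w d a refl le
... | P , R , refl , w₁ , w₂ = false ∷ P , R , refl , down w₁ , w₂

first-return : ∀ {p} → Dyck (true ∷ p) →
  Σ Path λ P → Σ Path λ R → (p ≡ P ++ false ∷ R) × Dyck P × Dyck R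
first-return (up w) = first-descent w 0 0 refl z≤n

¬dyck-prefix-then-down : ∀ {X c P R} → Walk 0 X c → Dyck P → X ≢ P ++ false ∷ R
¬dyck-prefix-then-down {P = P} w wP refl with walk-split P w
... | b , w₁ , w₂ with walk-end-unique w₁ wP
¬dyck-prefix-then-down w wP refl | .0 , w₁ , () | refl

first-return-unique : ∀ {P P′ R R′} → Dyck P → Dyck P′ → P ++ false ∷ R ≡ P′ ++ false ∷ R′ → P ≡ P′ × R ≡ R′
first-return-unique {P} {P′} {R} {R′} w w′ eq with ++-split P (false ∷ R) P′ (false ∷ R′) eq
... | inj₁ ([] , e₁ , e₂) = sym (trans e₁ (ListP.++-identityʳ P)) , proj₂ (ListP.∷-injective e₂)
... | inj₁ (_ ∷ _ , e₁ , e₂) with ListP.∷-injective e₂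
... | refl , _ = ⊥-elim (¬dyck-prefix-then-down w′ w e₁)
first-return-unique {P} {P′} w w′ eq | inj₂ ([] , e₁ , e₂) = trans e₁ (ListP.++-identityʳ P′) , sym (proj₂ (ListP.∷-injective e₂))
first-return-unique w w′ eq | inj₂ (_ ∷ _ , e₁ , e₂) with ListP.∷-injective e₂
... | refl , _ = ⊥-elim (¬dyck-prefix-then-down w w′ e₁)

prime-dyck-prefix : ∀ {X A rest} → Dyck X → true ∷ X ++ false ∷ [] ≡ A ++ rest → Dyck A → A ≡ [] ⊎ rest ≡ []
prime-dyck-prefix {A = []} wX eq wA = inj₁ refl
prime-dyck-prefix {X} {true ∷ A} {rest} wX eq (up wA) with first-descent wA 0 0 refl z≤n
... | P , R , refl , wP , _ with first-return-unique wX wP (trans (proj₂ (ListP.∷-injective eq)) (ListP.++-assoc P (false ∷ R) rest))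
... | _ , e = inj₂ (ListP.++-conicalʳ R rest (sym e))

last-return : ∀ {p} → Dyck p → p ≢ [] →
  Σ Path λ A → Σ Path λ X → (p ≡ A ++ true ∷ X ++ false ∷ []) × Dyck A × Dyck X
last-return {p} = go (length p) p ℕP.≤-refl
  where
  go : ∀ fuel p → length p ≤ fuel → Dyck p → p ≢ [] →
    Σ Path λ A → Σ Path λ X → (p ≡ A ++ true ∷ X ++ false ∷ []) × Dyck A × Dyck X
  go _          []         _        _ ne = ⊥-elim (ne refl)
  go zero       (true ∷ p) ()       _ _
  go (suc fuel) (true ∷ p) (s≤s le) w _ with first-return w
  ... | P , []      , refl , wP , _  = [] , P , refl , stop , wP
  ... | P , r ∷ R , refl , wP , wR with go fuel (r ∷ R) shorter wR (λ ())
    where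
    shorter : length (r ∷ R) ≤ fuel
    shorter = ℕP.≤-trans (ℕP.≤-trans (ℕP.n≤1+n _) (ℕP.m≤n+m _ (length P))) (ℕP.≤-trans (ℕP.≤-reflexive (sym (ListP.length-++ P))) le)
  ... | A , X , e , wA , wX = true ∷ P ++ false ∷ A , X ,
        cong (true ∷_) (trans (cong (λ R′ → P ++ false ∷ R′) e) (sym (ListP.++-assoc P (false ∷ A) _))) ,
        up (walk-++ (walk-lift wP) (down wA)) , wX

¬prime-overlap : ∀ {A m M X X′} → Dyck (A ++ m ∷ M) → Dyck A → Dyck X →
  true ∷ X ++ false ∷ [] ≢ m ∷ M ++ true ∷ X′ ++ false ∷ []
¬prime-overlap wAm wA wX e with prime-dyck-prefix wX e (dyck-suffix wAm wA)
... | inj₁ ()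
... | inj₂ ()

last-return-unique : ∀ {A X A′ X′} → Dyck A → Dyck X → Dyck A′ → Dyck X′ →
  A ++ true ∷ X ++ false ∷ [] ≡ A′ ++ true ∷ X′ ++ false ∷ [] → A ≡ A′ × X ≡ X′
last-return-unique {A} {X} {A′} {X′} wA wX wA′ wX′ eq with ++-split A (true ∷ X ++ false ∷ []) A′ (true ∷ X′ ++ false ∷ []) eq
... | inj₁ ([] , e₁ , e₂) = sym (trans e₁ (ListP.++-identityʳ A)) , ListP.∷ʳ-injectiveˡ X X′ (proj₂ (ListP.∷-injective e₂))
... | inj₁ (_ ∷ _ , refl , e₂) = ⊥-elim (¬prime-overlap wA′ wA wX e₂)
... | inj₂ ([] , e₁ , e₂) = trans e₁ (ListP.++-identityʳ A′) , sym (ListP.∷ʳ-injectiveˡ X′ X (proj₂ (ListP.∷-injective e₂)))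
... | inj₂ (_ ∷ _ , refl , e₂) = ⊥-elim (¬prime-overlap wA wA′ wX′ e₂)

dyck-prefix-past-last-return : ∀ {A₀ X A B} → Dyck A₀ → Dyck X → Dyck A →
  A ++ B ≡ A₀ ++ true ∷ X ++ false ∷ [] → length A₀ < length A → B ≡ []
dyck-prefix-past-last-return {A₀} {X} {A} {B} wA₀ wX wA eq A₀<A with ++-split A B A₀ (true ∷ X ++ false ∷ []) eq
... | inj₁ (N , refl , _) = ⊥-elim (ℕP.<⇒≱ A₀<A (ListP.length-++-≤ˡ A))
... | inj₂ (N , refl , e) with prime-dyck-prefix wX e (dyck-suffix wA wA₀)
...   | inj₂ B≡[] = B≡[]
...   | inj₁ refl = ⊥-elim (ℕP.<-irrefl (cong length (sym (ListP.++-identityʳ A₀))) A₀<A)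

length-last-return : ∀ (A X : Path) → length (A ++ true ∷ X ++ false ∷ []) ≡ 2 + length A + length X
length-last-return A X = begin
  length (A ++ true ∷ X ++ false ∷ []) ≡⟨ ListP.length-++ A ⟩
  length A + suc (length (X ++ false ∷ [])) ≡⟨ cong (λ n → length A + suc n) (ListP.length-++ X) ⟩
  length A + suc (length X + 1)        ≡⟨ regroup (length A) (length X) ⟩
  2 + length A + length X              ∎
  where
  open ≡-Reasoning
  regroup : ∀ a x → a + suc (x + 1) ≡ 2 + a + x
  regroup = ℕ-solve

ups : Path → ℕ
ups []          = 0
ups (true ∷ p)  = suc (ups p)
ups (false ∷ p) = ups p

downs : Path → ℕ
downs []          = 0
downs (true ∷ p)  = downs p
downs (false ∷ p) = suc (downs p)

walk-balance : ∀ {a p b} → Walk a p b → a + ups p ≡ b + downs p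
walk-balance stop = refl
walk-balance {a} (up {p = p} w) = trans (ℕP.+-suc a (ups p)) (walk-balance w)
walk-balance {p = false ∷ p} {b} (down w) = trans (cong suc (walk-balance w)) (sym (ℕP.+-suc b (downs p)))

length≡ups+downs : ∀ p → length p ≡ ups p + downs p
length≡ups+downs []          = refl
length≡ups+downs (true ∷ p)  = cong suc (length≡ups+downs p)
length≡ups+downs (false ∷ p) = trans (cong suc (length≡ups+downs p)) (sym (ℕP.+-suc (ups p) (downs p)))

dyck-length : ∀ {p} → Dyck p → length p ≡ 2 * ups p
dyck-length {p} w = begin
  length p            ≡⟨ length≡ups+downs p ⟩
  ups p + downs p     ≡⟨ cong (λ z → ups p + z) (sym (walk-balance w)) ⟩
  ups p + ups p       ≡⟨ cong (λ z → ups p + z) (sym (ℕP.+-identityʳ (ups p))) ⟩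
  ups p + (ups p + 0) ∎
  where open ≡-Reasoning

-- Heights

+-up : ∀ a z → + a ℤ.+ (+ 1 ℤ.+ z) ≡ + suc a ℤ.+ z
+-up a z = trans (sym (ℤP.+-assoc (+ a) (+ 1) z)) (cong (λ w → + w ℤ.+ z) (ℕP.+-comm a 1))

+-down : ∀ a z → + suc a ℤ.+ (ℤ.- (+ 1) ℤ.+ z) ≡ + a ℤ.+ z
+-down a z = trans (sym (ℤP.+-assoc (+ suc a) (ℤ.- (+ 1)) z)) (cong (ℤ._+ z) (suc-pred a))
  where
  suc-pred : ∀ a → + suc a ℤ.+ ℤ.- (+ 1) ≡ + a
  suc-pred zero    = refl
  suc-pred (suc a) = refl

hgt-++ : ∀ p q → hgt (p ++ q) ≡ hgt p ℤ.+ hgt q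
hgt-++ []      q = sym (ℤP.+-identityˡ (hgt q))
hgt-++ (b ∷ p) q = trans (cong (λ z → Δ b ℤ.+ z) (hgt-++ p q)) (sym (ℤP.+-assoc (Δ b) (hgt p) (hgt q)))

walk-hgt : ∀ {a p b} → Walk a p b → + a ℤ.+ hgt p ≡ + b
walk-hgt {a} stop = cong +_ (ℕP.+-identityʳ a)
walk-hgt {a} (up {p = p} w) = trans (+-up a (hgt p)) (walk-hgt w)
walk-hgt {suc a} (down {p = p} w) = trans (+-down a (hgt p)) (walk-hgt w)

dyck-hgt : ∀ {p} → Dyck p → hgt p ≡ + 0
dyck-hgt {p} w = trans (sym (ℤP.+-identityˡ (hgt p))) (walk-hgt w)

take-suc-stepAt : ∀ (p : Path) X → X < length p → take (suc X) p ≡ take X p ∷ʳ stepAt p X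
take-suc-stepAt (b ∷ p) zero    _        = refl
take-suc-stepAt (b ∷ p) (suc X) (s≤s lt) = cong (b ∷_) (take-suc-stepAt p X lt)

heightAt-suc : ∀ p X → X < length p → heightAt p (suc X) ≡ heightAt p X ℤ.+ Δ (stepAt p X)
heightAt-suc p X lt = trans (cong hgt (take-suc-stepAt p X lt))
  (trans (hgt-++ (take X p) (stepAt p X ∷ [])) (cong (λ z → heightAt p X ℤ.+ z) (ℤP.+-identityʳ (Δ (stepAt p X)))))

take-++ˡ : ∀ X (A B : Path) → X ≤ length A → take X (A ++ B) ≡ take X A
take-++ˡ zero    A       B le       = refl
take-++ˡ (suc X) (a ∷ A) B (s≤s le) = cong (a ∷_) (take-++ˡ X A B le)

take-++ʳ : ∀ (A B : Path) Y → take (length A + Y) (A ++ B) ≡ A ++ take Y B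
take-++ʳ []      B Y = refl
take-++ʳ (a ∷ A) B Y = cong (a ∷_) (take-++ʳ A B Y)

take-length-++ : ∀ (A B : Path) → take (length A) (A ++ B) ≡ A
take-length-++ []      B = refl
take-length-++ (a ∷ A) B = cong (a ∷_) (take-length-++ A B)

drop-length-++ : ∀ (A B : Path) → drop (length A) (A ++ B) ≡ B
drop-length-++ []      B = refl
drop-length-++ (a ∷ A) B = drop-length-++ A B

heightAt-++ˡ : ∀ X (A B : Path) → X ≤ length A → heightAt (A ++ B) X ≡ heightAt A X
heightAt-++ˡ X A B le = cong hgt (take-++ˡ X A B le)

heightAt-++ʳ : ∀ (A B : Path) Y → heightAt (A ++ B) (length A + Y) ≡ hgt A ℤ.+ heightAt B Y
heightAt-++ʳ A B Y = trans (cong hgt (take-++ʳ A B Y)) (hgt-++ A (take Y B))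

heightAt-beyond : ∀ p X → length p ≤ X → heightAt p X ≡ hgt p
heightAt-beyond p X le = cong hgt (ListP.take-all X p le)

walk-heightAt : ∀ {p b} → Walk 0 p b → ∀ X → Σ ℕ λ c → heightAt p X ≡ + c
walk-heightAt {p} w X with walk-split (take X p) (subst (λ q → Walk 0 q _) (sym (ListP.take++drop≡id X p)) w)
... | c , w₁ , _ = c , trans (sym (ℤP.+-identityˡ (hgt (take X p)))) (walk-hgt w₁)

parity : ℕ → ℕ
parity zero          = zero
parity (suc zero)    = suc zero
parity (suc (suc n)) = parity n

parity≤1 : ∀ n → parity n ≤ 1
parity≤1 zero          = z≤n
parity≤1 (suc zero)    = s≤s z≤n
parity≤1 (suc (suc n)) = parity≤1 n

parity-even : ∀ m → parity (2 * m) ≡ 0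
parity-even zero    = refl
parity-even (suc m) = trans (cong parity (cong suc (ℕP.+-suc m (m + 0)))) (parity-even m)

parity-odd : ∀ m → parity (2 * m + 1) ≡ 1
parity-odd zero    = refl
parity-odd (suc m) = trans (cong parity (cong suc (cong (_+ 1) (ℕP.+-suc m (m + 0))))) (parity-odd m)

parity-decomp : ∀ n → Σ ℕ λ j → n ≡ parity n + 2 * j
parity-decomp zero          = 0 , refl
parity-decomp (suc zero)    = 0 , refl
parity-decomp (suc (suc n)) with parity-decomp n
... | j , e = suc j , trans (cong (λ z → suc (suc z)) e) (shift (parity n) j)
  where
  shift : ∀ a j → suc (suc (a + 2 * j)) ≡ a + 2 * suc j
  shift = ℕ-solve

walk-heightAt-parity : ∀ {h p b} → Walk h p b → ∀ X → X ≤ length p →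
  Σ ℕ λ j → + h ℤ.+ heightAt p X ≡ + (parity (h + X) + 2 * j)
walk-heightAt-parity {h} w zero le with parity-decomp (h + 0)
... | j , e = j , trans (cong +_ (ℕP.+-identityʳ h)) (cong +_ (trans (sym (ℕP.+-identityʳ h)) e))
walk-heightAt-parity {h} (up {p = p} w) (suc X) (s≤s le) with walk-heightAt-parity w X le
... | j , e = j , trans (+-up h (heightAt p X)) (trans e (cong (λ z → + (parity z + 2 * j)) (sym (ℕP.+-suc h X))))
walk-heightAt-parity {suc h} (down {p = p} w) (suc X) (s≤s le) with walk-heightAt-parity w X le
... | j , e = j , trans (+-down h (heightAt p X)) (trans e (cong (λ z → + (parity (suc z) + 2 * j)) (sym (ℕP.+-suc h X))))

length-Z : ∀ k → length (Z k) ≡ 2 * k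
length-Z zero    = refl
length-Z (suc k) = cong suc (trans (cong suc (length-Z k)) (sym (ℕP.+-suc k (k + 0))))

dyck-Z : ∀ k → Dyck (Z k)
dyck-Z zero    = stop
dyck-Z (suc k) = up (down (dyck-Z k))

heightAt-Z : ∀ k X → X ≤ 2 * k → heightAt (Z k) X ≡ + parity X
heightAt-Z k       zero          le = refl
heightAt-Z zero    (suc X)       ()
heightAt-Z (suc k) (suc zero)    le = refl
heightAt-Z (suc k) (suc (suc X)) (s≤s le) =
  trans (+-down 0 (heightAt (Z k) X)) (trans (ℤP.+-identityˡ _) (heightAt-Z k X X≤2k))
  where
  X≤2k : X ≤ 2 * k
  X≤2k = ℕP.≤-pred (ℕP.≤-trans le (ℕP.≤-reflexive (ℕP.+-suc k (k + 0))))

spreadPath-Z : ∀ a k → a ≤ k → spreadPath (2 * a) (Z k) ≡ Z (suc k)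
spreadPath-Z zero    k       le       = refl
spreadPath-Z (suc a) (suc k) (s≤s le) =
  subst (λ s → spreadPath s (Z (suc k)) ≡ Z (suc (suc k))) (sym (cong suc (ℕP.+-suc a (a + 0))))
    (cong (λ z → true ∷ false ∷ z) (spreadPath-Z a k le))

Dyck⇒IsDyckPath : ∀ {n p} → Dyck p → length p ≡ 2 * n → IsDyckPath n p
Dyck⇒IsDyckPath {n} {p} w l = l , nonneg , trans (heightAt-beyond p (length p) ℕP.≤-refl) (dyck-hgt w)
  where
  nonneg : ∀ X → + 0 ℤ.≤ heightAt p X
  nonneg X with walk-heightAt w X
  ... | c , e = subst (+ 0 ℤ.≤_) (sym e) (ℤ.+≤+ z≤n)

IsDyckPath⇒Dyck : ∀ {n p} → IsDyckPath n p → Dyck p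
IsDyckPath⇒Dyck {n} {p} (_ , nonneg , end) with walk-from 0 p (λ X → subst (+ 0 ℤ.≤_) (sym (ℤP.+-identityˡ _)) (nonneg X))
  where
  walk-from : ∀ h p → (∀ X → + 0 ℤ.≤ + h ℤ.+ heightAt p X) → Σ ℕ λ c → Walk h p c × (+ h ℤ.+ hgt p ≡ + c)
  walk-from h [] _ = h , stop , cong +_ (ℕP.+-identityʳ h)
  walk-from h (true ∷ p) nn with walk-from (suc h) p (λ X → subst (+ 0 ℤ.≤_) (+-up h (heightAt p X)) (nn (suc X)))
  ... | c , w , e = c , up w , trans (+-up h (hgt p)) e
  walk-from zero (false ∷ p) nn with nn 1
  ... | ()
  walk-from (suc h) (false ∷ p) nn with walk-from h p (λ X → subst (+ 0 ℤ.≤_) (+-down h (heightAt p X)) (nn (suc X)))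
  ... | c , w , e = c , down w , trans (+-down h (hgt p)) e
... | c , w , e with trans (sym e) (trans (ℤP.+-identityˡ (hgt p)) (trans (sym (heightAt-beyond p (length p) ℕP.≤-refl)) end))
... | refl = w

-- One-box tilings over the zig-zag path

double-suc : ∀ k → 2 * suc k ≡ 2 + 2 * k
double-suc = ℕ-solve

two-levels : ∀ a j → a + 2 * j + 2 ≡ a + 2 * suc j
two-levels = ℕ-solve

level-injective : ∀ a j j′ → a + 2 * j ≡ a + 2 * j′ → j ≡ j′
level-injective a j j′ e = ℕP.*-cancelˡ-≡ j j′ 2 (ℕP.+-cancelˡ-≡ a _ _ e)

level-<⁻ : ∀ a j j′ → a + 2 * j + 2 ≤ a + 2 * j′ → j < j′
level-<⁻ a j j′ le = ℕP.*-cancelˡ-≤ 2 (ℕP.+-cancelˡ-≤ a _ _ (subst (_≤ a + 2 * j′) (two-levels a j) le))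

level-<⁺ : ∀ a j j′ → j < j′ → a + 2 * j + 2 ≤ a + 2 * j′
level-<⁺ a j j′ lt = subst (_≤ a + 2 * j′) (sym (two-levels a j)) (ℕP.+-monoʳ-≤ a (ℕP.*-monoʳ-≤ 2 lt))

-- Over Z k, box bottoms and upper heights in column X have the form parity X + 2 j; boxes are
-- then described by their level j, strictly below the level j′ of μ.
InSkew-Z⁻ : ∀ {k μ X Y} → Dyck μ → length μ ≡ 2 * k → InSkew (Z k) μ (X , Y) →
  Σ ℕ λ j → Σ ℕ λ j′ → (X < 2 * k) × (Y ≡ + (parity X + 2 * j)) × (heightAt μ X ≡ + (parity X + 2 * j′)) × (j < j′)
InSkew-Z⁻ {k} {μ} {X} {Y} w l (lt , (j , eY) , le)
  with walk-heightAt-parity w X (ℕP.≤-trans (ℕP.<⇒≤ (subst (X <_) (length-Z k) lt)) (ℕP.≤-reflexive (sym l)))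
... | j′ , eμ = j , j′ , X<2k , eY′ , eμ′ , level-<⁻ (parity X) j j′ (ℤP.drop‿+≤+ (subst₂ ℤ._≤_ (cong (ℤ._+ + 2) eY′) eμ′ le))
  where
  X<2k : X < 2 * k
  X<2k = subst (X <_) (length-Z k) lt
  eY′ : Y ≡ + (parity X + 2 * j)
  eY′ = trans eY (cong (ℤ._+ + (2 * j)) (heightAt-Z k X (ℕP.<⇒≤ X<2k)))
  eμ′ : heightAt μ X ≡ + (parity X + 2 * j′)
  eμ′ = trans (sym (ℤP.+-identityˡ _)) eμ

InSkew-Z⁺ : ∀ {k μ X Y} j j′ → X < 2 * k → j < j′ → Y ≡ + (parity X + 2 * j) → heightAt μ X ≡ + (parity X + 2 * j′) →
  InSkew (Z k) μ (X , Y)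
InSkew-Z⁺ {k} {μ} {X} {Y} j j′ lt jj eY eμ =
  subst (X <_) (sym (length-Z k)) lt ,
  (j , trans eY (sym (cong (ℤ._+ + (2 * j)) (heightAt-Z k X (ℕP.<⇒≤ lt))))) ,
  subst₂ ℤ._≤_ (cong (ℤ._+ + 2) (sym eY)) (sym eμ) (ℤ.+≤+ (level-<⁺ (parity X) j j′ jj))

¬InSkew-Z-at-bottom : ∀ {k μ X Y} → Dyck μ → length μ ≡ 2 * k → heightAt μ X ≡ + parity X → ¬ InSkew (Z k) μ (X , Y)
¬InSkew-Z-at-bottom {k} {X = X} w l e s with InSkew-Z⁻ {k} w l s
... | j , suc j′ , _ , _ , eμ , _ with ℤP.+-injective (trans (sym eμ) e)
... | e′ with ℕP.+-cancelˡ-≡ (parity X) _ _ (trans e′ (sym (ℕP.+-identityʳ (parity X))))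
... | ()

-- The tilings of the statement, in a normal form where the tiles are the boxes of the skew shape.
record OneBoxZ (k : ℕ) (T : Tiling) : Set where
  field
    lower≡Z      : lower T ≡ Z k
    upper-dyck   : Dyck (upper T)
    upper-length : length (upper T) ≡ 2 * k
    tiles-unique : Unique (tiles T)
    tiles-oneBox : All IsOneBox (tiles T)
    tiles-inSkew : ∀ {t} → t ∈ tiles T → InSkew (Z k) (upper T) (x t , y t)
    tiles-cover  : ∀ X Y → InSkew (Z k) (upper T) (X , Y) → tile X Y [] ∈ tiles T

open OneBoxZ public

OneBoxZ-empty : OneBoxZ 0 emptyTiling
OneBoxZ-empty = record
  { lower≡Z = refl ; upper-dyck = stop ; upper-length = refl ; tiles-unique = [] ; tiles-oneBox = []
  ; tiles-inSkew = λ () ; tiles-cover = λ { X Y (() , _) } }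

oneBox-η : ∀ {t} → IsOneBox t → t ≡ tile (x t) (y t) []
oneBox-η {tile a b .[]} refl = refl

lowerCorner : Tile → Box
lowerCorner t = (x t , y t)

allBoxes-oneBox : ∀ ts → All IsOneBox ts → concatMap boxesOf ts ≡ map lowerCorner ts
allBoxes-oneBox []                  []           = refl
allBoxes-oneBox (tile a b .[] ∷ ts) (refl ∷ obs) = cong ((a , b) ∷_) (allBoxes-oneBox ts obs)

Unique-lowerCorners : ∀ {ts} → All IsOneBox ts → Unique ts → Unique (map lowerCorner ts)
Unique-lowerCorners obs u = Unique-map-on lowerCorner u
  (λ mu mv e → trans (oneBox-η (All.lookup obs mu))
                 (trans (cong (λ b → tile (proj₁ b) (proj₂ b) []) e) (sym (oneBox-η (All.lookup obs mv)))))

dyck-above-Z : ∀ k μ → Dyck μ → length μ ≡ 2 * k → WeaklyAbove μ (Z k)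
dyck-above-Z k μ w l X with X ℕ.≤? 2 * k
... | yes le with walk-heightAt-parity w X (subst (X ≤_) (sym l) le)
... | j , e = subst₂ ℤ._≤_ (sym (heightAt-Z k X le)) (trans (sym e) (ℤP.+-identityˡ _)) (ℤ.+≤+ (ℕP.m≤m+n (parity X) (2 * j)))
dyck-above-Z k μ w l X | no gt =
  subst₂ ℤ._≤_ (sym (trans (heightAt-beyond (Z k) X (beyond (Z k) (length-Z k))) (dyck-hgt (dyck-Z k))))
    (sym (trans (heightAt-beyond μ X (beyond μ l)) (dyck-hgt w))) ℤP.≤-refl
  where
  beyond : ∀ (p : Path) → length p ≡ 2 * k → length p ≤ X
  beyond p l′ = subst (_≤ X) (sym l′) (ℕP.<⇒≤ (ℕP.≰⇒> gt))

OneBoxZ⇒OneBoxZTiling : ∀ n T → OneBoxZ n T → OneBoxZTiling n T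
OneBoxZ⇒OneBoxZTiling n (mkTiling lo μ ts) G with lower≡Z G
... | refl =
  refl ,
  ( Dyck⇒IsDyckPath {n} (dyck-Z n) (length-Z n) , Dyck⇒IsDyckPath {n} (upper-dyck G) (upper-length G)
  , dyck-above-Z n μ (upper-dyck G) (upper-length G)
  , All.map oneBox-dyckTile (tiles-oneBox G)
  , subst Unique (sym corners) (Unique-lowerCorners (tiles-oneBox G) (tiles-unique G))
  , subst (All (InSkew (Z n) μ)) (sym corners) (All.tabulate inSkew)
  , (λ b s → subst (b ∈_) (sym corners) (cover b s))
  , coverInclusive ) ,
  tiles-oneBox G
  where
  corners : concatMap boxesOf ts ≡ map lowerCorner ts
  corners = allBoxes-oneBox ts (tiles-oneBox G)
  oneBox-dyckTile : ∀ {t} → IsOneBox t → IsDyckTile t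
  oneBox-dyckTile {tile a b .[]} refl = (ℤP.≤-refl ∷ []) , ℤP.+-identityʳ b
  inSkew : ∀ {b} → b ∈ map lowerCorner ts → InSkew (Z n) μ b
  inSkew m with ∈P.∈-map⁻ lowerCorner m
  ... | t , m′ , refl = tiles-inSkew G m′
  cover : ∀ b → InSkew (Z n) μ b → b ∈ map lowerCorner ts
  cover (X , Y) s = ∈P.∈-map⁺ lowerCorner (tiles-cover G X Y s)
  coverInclusive : CoverInclusive ts
  coverInclusive {t₁} {t₂} m₁ m₂ X Y b₁ b₂ with All.lookup (tiles-oneBox G) m₁ | All.lookup (tiles-oneBox G) m₂
  coverInclusive {tile _ _ .[]} {tile _ _ .[]} _ _ _ _ (here refl) (here refl) | refl | refl = ℕP.≤-refl , ℕP.≤-refl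

OneBoxZTiling⇒OneBoxZ : ∀ n T → OneBoxZTiling n T → OneBoxZ n T
OneBoxZTiling⇒OneBoxZ n (mkTiling lo μ ts) (refl , (_ , dμ , _ , _ , ub , sk , cov , _) , obs) = record
  { lower≡Z = refl ; upper-dyck = IsDyckPath⇒Dyck {n} dμ ; upper-length = proj₁ dμ
  ; tiles-unique = UniqueP.map⁻ (subst Unique corners ub)
  ; tiles-oneBox = obs
  ; tiles-inSkew = λ m → All.lookup (subst (All (InSkew (Z n) μ)) corners sk) (∈P.∈-map⁺ lowerCorner m)
  ; tiles-cover = cover }
  where
  corners : concatMap boxesOf ts ≡ map lowerCorner ts
  corners = allBoxes-oneBox ts obs
  cover : ∀ X Y → InSkew (Z n) μ (X , Y) → tile X Y [] ∈ ts
  cover X Y s with ∈P.∈-map⁻ lowerCorner (subst ((X , Y) ∈_) corners (cov (X , Y) s))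
  ... | t , m , refl = subst (_∈ ts) (oneBox-η (All.lookup obs m)) m

OneBoxZ-≈ : ∀ k T T′ → OneBoxZ k T → OneBoxZ k T′ → upper T ≡ upper T′ → T ≈T T′
OneBoxZ-≈ k (mkTiling lo μ ts) (mkTiling lo′ .μ ts′) G G′ refl with lower≡Z G | lower≡Z G′
... | refl | refl = refl , refl , unique-same-members⇒↭ (tiles-unique G) (tiles-unique G′) (transfer G G′) (transfer G′ G)
  where
  transfer : ∀ {us vs} → OneBoxZ k (mkTiling (Z k) μ us) → OneBoxZ k (mkTiling (Z k) μ vs) → ∀ {t} → t ∈ us → t ∈ vs
  transfer H H′ m = subst (_∈ _) (sym (oneBox-η (All.lookup (tiles-oneBox H) m))) (tiles-cover H′ _ _ (tiles-inSkew H m))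

-- Spreading

heightAt-++UD-≤ : ∀ (A B : Path) X → X ≤ length A → heightAt (A ++ true ∷ false ∷ B) X ≡ heightAt (A ++ B) X
heightAt-++UD-≤ A B X le = trans (heightAt-++ˡ X A _ le) (sym (heightAt-++ˡ X A B le))

heightAt-++UD-peak : ∀ (A B : Path) → heightAt (A ++ true ∷ false ∷ B) (length A + 1) ≡ hgt A ℤ.+ + 1
heightAt-++UD-peak A B = heightAt-++ʳ A _ 1

heightAt-++UD-shift : ∀ (A B : Path) a → length A ≤ a → heightAt (A ++ true ∷ false ∷ B) (2 + a) ≡ heightAt (A ++ B) a
heightAt-++UD-shift A B a le with ℕP.m≤n⇒∃[o]m+o≡n le
... | Y , refl = begin
  heightAt (A ++ true ∷ false ∷ B) (2 + (length A + Y)) ≡⟨ cong (heightAt (A ++ true ∷ false ∷ B)) (move-2 (length A) Y) ⟩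
  heightAt (A ++ true ∷ false ∷ B) (length A + (2 + Y)) ≡⟨ heightAt-++ʳ A _ (2 + Y) ⟩
  hgt A ℤ.+ heightAt (true ∷ false ∷ B) (2 + Y)         ≡⟨ cong (λ z → hgt A ℤ.+ z) (trans (+-down 0 (heightAt B Y)) (ℤP.+-identityˡ _)) ⟩
  hgt A ℤ.+ heightAt B Y                                ≡⟨ sym (heightAt-++ʳ A B Y) ⟩
  heightAt (A ++ B) (length A + Y)                      ∎
  where
  open ≡-Reasoning
  move-2 : ∀ S Y → 2 + (S + Y) ≡ S + (2 + Y)
  move-2 = ℕ-solve

data Around (S : ℕ) : ℕ → Set where
  before : ∀ {X} → X < S → Around S X
  at     : Around S S
  peak   : Around S (S + 1)
  after  : Around S (S + 2)
  beyond : ∀ {a} → S < a → Around S (2 + a)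

around : ∀ S X → Around S X
around S X with ℕP.<-cmp X S
... | tri< lt _ _ = before lt
... | tri≈ _ refl _ = at
... | tri> _ _ gt with ℕP.m≤n⇒∃[o]m+o≡n gt
... | zero , refl = subst (Around S) (e₁ S) peak
  where
  e₁ : ∀ S → S + 1 ≡ suc S + 0
  e₁ = ℕ-solve
... | suc zero , refl = subst (Around S) (e₂ S) after
  where
  e₂ : ∀ S → S + 2 ≡ suc S + 1
  e₂ = ℕ-solve
... | suc (suc Y) , refl = subst (Around S) (e₃ S Y) (beyond (ℕP.m<m+n S (s≤s z≤n)))
  where
  e₃ : ∀ S Y → 2 + (S + suc Y) ≡ suc S + suc (suc Y)
  e₃ = ℕ-solve

shiftCol : ℕ → ℕ → ℕ
shiftCol S a = if S <ᵇ a then 2 + a else a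

shiftCol-< : ∀ {S a} → a < S → shiftCol S a ≡ a
shiftCol-< lt rewrite <ᵇ-false (ℕP.<⇒≤ lt) = refl

shiftCol-> : ∀ {S a} → S < a → shiftCol S a ≡ 2 + a
shiftCol-> lt rewrite <ᵇ-true lt = refl

spreadTile-oneBox : ∀ S a b → a ≢ S → spreadTile S (tile a b []) ≡ tile (shiftCol S a) b []
spreadTile-oneBox S a b ne with S <ᵇ a in eq
... | true  = refl
... | false rewrite ≤ᵇ-false {S} {a + 0} (subst (_< S) (sym (ℕP.+-identityʳ a)) (ℕP.≤∧≢⇒< (<ᵇ-false⇒≥ eq) ne)) = refl

module Spread (k : ℕ) (A B : Path) (ts : List Tile) (G : OneBoxZ k (mkTiling (Z k) (A ++ B) ts)) (wA : Dyck A) where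
  S = length A
  μ = A ++ B
  ν = A ++ true ∷ false ∷ B

  wB : Dyck B
  wB = dyck-suffix (upper-dyck G) wA

  S≡2ups : S ≡ 2 * ups A
  S≡2ups = dyck-length wA

  parity-S : parity S ≡ 0
  parity-S = trans (cong parity S≡2ups) (parity-even (ups A))

  μ-at-S : heightAt μ S ≡ + 0
  μ-at-S = trans (cong hgt (take-length-++ A B)) (dyck-hgt wA)

  S+|B| : S + length B ≡ 2 * k
  S+|B| = trans (sym (ListP.length-++ A)) (upper-length G)

  S≤2k : S ≤ 2 * k
  S≤2k = subst (S ≤_) S+|B| (ℕP.m≤m+n S (length B))

  length-ν : length ν ≡ 2 * suc k
  length-ν = begin
    length (A ++ true ∷ false ∷ B) ≡⟨ ListP.length-++ A ⟩
    S + (2 + length B)             ≡⟨ ℕP.+-suc S _ ⟩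
    suc (S + suc (length B))       ≡⟨ cong suc (ℕP.+-suc S _) ⟩
    2 + (S + length B)             ≡⟨ cong (λ n → 2 + n) S+|B| ⟩
    2 + 2 * k                      ≡⟨ sym (double-suc k) ⟩
    2 * suc k                      ∎
    where open ≡-Reasoning

  dyck-ν : Dyck ν
  dyck-ν = walk-++ wA (up (down wB))

  no-box-at-S : ∀ {t} → t ∈ ts → x t ≢ S
  no-box-at-S m refl = ¬InSkew-Z-at-bottom {k} (upper-dyck G) (upper-length G)
    (trans μ-at-S (cong +_ (sym parity-S))) (tiles-inSkew G m)

  lower-ν : spreadPath S (Z k) ≡ Z (suc k)
  lower-ν = subst (λ s → spreadPath s (Z k) ≡ Z (suc k)) (sym S≡2ups)
    (spreadPath-Z (ups A) k (ℕP.*-cancelˡ-≤ 2 (subst (_≤ 2 * k) S≡2ups S≤2k)))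

  upper-ν : spreadPath S μ ≡ ν
  upper-ν = cong₂ (λ p q → p ++ true ∷ false ∷ q) (take-length-++ A B) (drop-length-++ A B)

  spreadTile-∈ : ∀ {t} → t ∈ ts → spreadTile S t ≡ tile (shiftCol S (x t)) (y t) []
  spreadTile-∈ {t} m = trans (cong (spreadTile S) (oneBox-η {t} (All.lookup (tiles-oneBox G) m))) (spreadTile-oneBox S (x t) (y t) (no-box-at-S m))

  shiftCol-separates : ∀ {a a′} → a < S → S < a′ → shiftCol S a ≢ shiftCol S a′
  shiftCol-separates {a} {a′} l g e = ℕP.<-irrefl refl (ℕP.<-trans (ℕP.<-trans l g)
    (subst (a′ <_) (trans (sym (shiftCol-> g)) (trans (sym e) (shiftCol-< l))) (ℕP.m<n+m a′ (s≤s z≤n))))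

  shiftCol-injective : ∀ a a′ → a ≢ S → a′ ≢ S → shiftCol S a ≡ shiftCol S a′ → a ≡ a′
  shiftCol-injective a a′ ne ne′ e with ℕP.<-cmp a S | ℕP.<-cmp a′ S
  ... | tri< l _ _ | tri< l′ _ _ = trans (sym (shiftCol-< l)) (trans e (shiftCol-< l′))
  ... | tri> _ _ g | tri> _ _ g′ = ℕP.+-cancelˡ-≡ 2 _ _ (trans (sym (shiftCol-> g)) (trans e (shiftCol-> g′)))
  ... | tri< l _ _ | tri> _ _ g′ = ⊥-elim (shiftCol-separates l g′ e)
  ... | tri> _ _ g | tri< l′ _ _ = ⊥-elim (shiftCol-separates l′ g (sym e))
  ... | tri≈ _ e′ _ | _ = ⊥-elim (ne e′)
  ... | _ | tri≈ _ e′ _ = ⊥-elim (ne′ e′)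

  heightAt-shiftCol : ∀ a → a ≢ S → heightAt ν (shiftCol S a) ≡ heightAt μ a
  heightAt-shiftCol a ne with ℕP.<-cmp a S
  ... | tri< l _ _ = trans (cong (heightAt ν) (shiftCol-< l)) (heightAt-++UD-≤ A B a (ℕP.<⇒≤ l))
  ... | tri> _ _ g = trans (cong (heightAt ν) (shiftCol-> g)) (heightAt-++UD-shift A B a (ℕP.<⇒≤ g))
  ... | tri≈ _ e _ = ⊥-elim (ne e)

  parity-shiftCol : ∀ a → parity (shiftCol S a) ≡ parity a
  parity-shiftCol a with S <ᵇ a
  ... | true  = refl
  ... | false = refl

  shiftCol-bound : ∀ a → a < 2 * k → shiftCol S a < 2 * suc k
  shiftCol-bound a lt with S <ᵇ a
  ... | true  = subst (2 + a <_) (sym (double-suc k)) (s≤s (s≤s lt))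
  ... | false = ℕP.<-≤-trans lt (ℕP.*-monoʳ-≤ 2 (ℕP.n≤1+n k))

  inSkew-ν : ∀ {t′} → t′ ∈ map (spreadTile S) ts → InSkew (Z (suc k)) ν (x t′ , y t′)
  inSkew-ν m with ∈P.∈-map⁻ (spreadTile S) m
  ... | t , m₀ , refl rewrite spreadTile-∈ m₀ with InSkew-Z⁻ {k} (upper-dyck G) (upper-length G) (tiles-inSkew G m₀)
  ... | j , j′ , lt , eY , eμ , jj =
    InSkew-Z⁺ {suc k} j j′ (shiftCol-bound (x t) lt) jj
      (trans eY (cong (λ z → + (z + 2 * j)) (sym (parity-shiftCol (x t)))))
      (trans (heightAt-shiftCol (x t) (no-box-at-S m₀)) (trans eμ (cong (λ z → + (z + 2 * j′)) (sym (parity-shiftCol (x t))))))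

  -- The three new columns S, S + 1, S + 2 lie on the bottom of the skew shape.
  cover-ν : ∀ X Y → InSkew (Z (suc k)) ν (X , Y) → tile X Y [] ∈ map (spreadTile S) ts
  cover-ν X Y s with around S X
  ... | at = ⊥-elim (¬InSkew-Z-at-bottom {suc k} dyck-ν length-ν
          (trans (heightAt-++UD-≤ A B S ℕP.≤-refl) (trans μ-at-S (cong +_ (sym parity-S)))) s)
  ... | peak = ⊥-elim (¬InSkew-Z-at-bottom {suc k} dyck-ν length-ν
          (trans (heightAt-++UD-peak A B) (trans (cong (ℤ._+ + 1) (dyck-hgt wA))
             (cong +_ (sym (trans (cong (λ z → parity (z + 1)) S≡2ups) (parity-odd (ups A))))))) s)
  ... | after = ⊥-elim (¬InSkew-Z-at-bottom {suc k} dyck-ν length-ν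
          (trans (cong (heightAt ν) (ℕP.+-comm S 2)) (trans (heightAt-++UD-shift A B S ℕP.≤-refl) (trans μ-at-S
             (cong +_ (sym (trans (cong parity (ℕP.+-comm S 2)) parity-S)))))) s)
  ... | before {X} lt′ with InSkew-Z⁻ {suc k} dyck-ν length-ν s
  ... | j , j′ , _ , eY , eν , jj =
    subst (_∈ map (spreadTile S) ts) (trans (spreadTile-∈ m₀) (cong (λ z → tile z Y []) (shiftCol-< lt′))) (∈P.∈-map⁺ (spreadTile S) m₀)
    where
    m₀ : tile X Y [] ∈ ts
    m₀ = tiles-cover G X Y (InSkew-Z⁺ {k} j j′ (ℕP.<-≤-trans lt′ S≤2k) jj eY (trans (sym (heightAt-++UD-≤ A B X (ℕP.<⇒≤ lt′))) eν))
  cover-ν _ Y s | beyond {a} gt with InSkew-Z⁻ {suc k} dyck-ν length-ν s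
  ... | j , j′ , lt , eY , eν , jj =
    subst (_∈ map (spreadTile S) ts) (trans (spreadTile-∈ m₀) (cong (λ z → tile z Y []) (shiftCol-> gt))) (∈P.∈-map⁺ (spreadTile S) m₀)
    where
    a<2k : a < 2 * k
    a<2k = ℕP.≤-pred (ℕP.≤-pred (subst (suc (2 + a) ≤_) (double-suc k) lt))
    m₀ : tile a Y [] ∈ ts
    m₀ = tiles-cover G a Y (InSkew-Z⁺ {k} j j′ a<2k jj eY (trans (sym (heightAt-++UD-shift A B a (ℕP.<⇒≤ gt))) eν))

  oneBoxZ-ν : OneBoxZ (suc k) (mkTiling (Z (suc k)) ν (map (spreadTile S) ts))
  oneBoxZ-ν = record
    { lower≡Z = refl ; upper-dyck = dyck-ν ; upper-length = length-ν
    ; tiles-unique = Unique-map-on (spreadTile S) (tiles-unique G) spreadTile-injective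
    ; tiles-oneBox = All.tabulate oneBox
    ; tiles-inSkew = inSkew-ν ; tiles-cover = cover-ν }
    where
    spreadTile-injective : ∀ {u v} → u ∈ ts → v ∈ ts → spreadTile S u ≡ spreadTile S v → u ≡ v
    spreadTile-injective {u} {v} mu mv e with trans (sym (spreadTile-∈ mu)) (trans e (spreadTile-∈ mv))
    ... | e′ = trans (oneBox-η (All.lookup (tiles-oneBox G) mu))
                 (trans (cong₂ (λ a b → tile a b []) (shiftCol-injective (x u) (x v) (no-box-at-S mu) (no-box-at-S mv) (cong x e′)) (cong y e′))
                   (sym (oneBox-η (All.lookup (tiles-oneBox G) mv))))
    oneBox : ∀ {t′} → t′ ∈ map (spreadTile S) ts → IsOneBox t′
    oneBox m with ∈P.∈-map⁻ (spreadTile S) m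
    ... | t , m₀ , refl rewrite spreadTile-∈ m₀ = refl

  spread-≡ : spread S (mkTiling (Z k) μ ts) ≡ mkTiling (Z (suc k)) ν (map (spreadTile S) ts)
  spread-≡ = cong₂ (λ l u → mkTiling l u (map (spreadTile S) ts)) lower-ν upper-ν

spread-OneBoxZ : ∀ k T A B → OneBoxZ k T → upper T ≡ A ++ B → Dyck A →
  OneBoxZ (suc k) (spread (length A) T) × upper (spread (length A) T) ≡ A ++ true ∷ false ∷ B
spread-OneBoxZ k (mkTiling lo μ ts) A B G refl wA with lower≡Z G
... | refl = subst (OneBoxZ (suc k)) (sym spread-≡) oneBoxZ-ν , cong upper spread-≡
  where open Spread k A B ts G wA

-- Adding boxes on top

step-direction : ∀ z b → ⌊ z ℤ.<? z ℤ.+ Δ b ⌋ ≡ b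
step-direction z true  = ⌊⌋-true (z ℤ.<? _) (subst (ℤ._< z ℤ.+ + 1) (ℤP.+-identityʳ z) (ℤP.+-monoʳ-< z (ℤ.+<+ (s≤s z≤n))))
step-direction z false = ⌊⌋-false (z ℤ.<? _) (λ lt → ℤP.<-asym lt (subst (z ℤ.+ -[1+ 0 ] ℤ.<_) (ℤP.+-identityʳ z) (ℤP.+-monoʳ-< z ℤ.-<+)))

map-upTo-cong : ∀ {A : Set} L (f g : ℕ → A) → (∀ i → i < L → f i ≡ g i) → map f (upTo L) ≡ map g (upTo L)
map-upTo-cong L f g pt = ListP.map-cong-local (All.tabulate (λ {i} m → pt i (∈P.∈-upTo⁻ m)))

steps-from-heights : ∀ ν → map (λ i → ⌊ heightAt ν i ℤ.<? heightAt ν (suc i) ⌋) (upTo (length ν)) ≡ ν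
steps-from-heights ν = begin
  map (λ i → ⌊ heightAt ν i ℤ.<? heightAt ν (suc i) ⌋) (upTo (length ν)) ≡⟨ map-upTo-cong (length ν) _ (stepAt ν) step ⟩
  map (stepAt ν) (upTo (length ν))                                      ≡⟨ ListP.map-upTo (stepAt ν) (length ν) ⟩
  applyUpTo (stepAt ν) (length ν)                                       ≡⟨ applyUpTo-stepAt ν ⟩
  ν                                                                     ∎
  where
  open ≡-Reasoning
  step : ∀ i → i < length ν → ⌊ heightAt ν i ℤ.<? heightAt ν (suc i) ⌋ ≡ stepAt ν i
  step i lt = trans (cong (λ h → ⌊ heightAt ν i ℤ.<? h ⌋) (heightAt-suc ν i lt)) (step-direction (heightAt ν i) (stepAt ν i))
  applyUpTo-stepAt : ∀ ν → applyUpTo (stepAt ν) (length ν) ≡ ν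
  applyUpTo-stepAt []      = refl
  applyUpTo-stepAt (b ∷ ν) = cong (b ∷_) (applyUpTo-stepAt ν)

lift : Bool → ℤ
lift b = if b then + 2 else + 0

module AddOnTop (k : ℕ) (μ : Path) (ts : List Tile) (G : OneBoxZ k (mkTiling (Z k) μ ts)) (Xs : List ℕ) (ν : Path)
   (Xs-unique : Unique Xs) (Xs-bound : ∀ {X} → X ∈ Xs → X < length μ) (dyck-ν : Dyck ν) (length-ν : length ν ≡ length μ)
   (ν-height : ∀ X → X ≤ length μ → heightAt ν X ≡ heightAt μ X ℤ.+ lift (X ∈ᵇ Xs)) where

  newTile : ℕ → Tile
  newTile X = tile X (heightAt μ X) []

  raise≡ν : raise Xs μ ≡ ν
  raise≡ν = trans (map-upTo-cong (length μ) _ _ same-step)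
    (subst (λ L → map (λ i → ⌊ heightAt ν i ℤ.<? heightAt ν (suc i) ⌋) (upTo L) ≡ ν) length-ν (steps-from-heights ν))
    where
    same-step : ∀ i → i < length μ →
      ⌊ (heightAt μ i ℤ.+ lift (i ∈ᵇ Xs)) ℤ.<? (heightAt μ (suc i) ℤ.+ lift (suc i ∈ᵇ Xs)) ⌋ ≡ ⌊ heightAt ν i ℤ.<? heightAt ν (suc i) ⌋
    same-step i lt = cong₂ (λ a b → ⌊ a ℤ.<? b ⌋) (sym (ν-height i (ℕP.<⇒≤ lt))) (sym (ν-height (suc i) lt))

  μ-level : ∀ X → X < length μ → Σ ℕ λ j′ → heightAt μ X ≡ + (parity X + 2 * j′)
  μ-level X lt with walk-heightAt-parity (upper-dyck G) X (ℕP.<⇒≤ lt)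
  ... | j′ , e = j′ , trans (sym (ℤP.+-identityˡ _)) e

  ν-level : ∀ X → X < length μ → ∀ j′ → heightAt μ X ≡ + (parity X + 2 * j′) →
     ((X ∈ᵇ Xs) ≡ true × heightAt ν X ≡ + (parity X + 2 * suc j′)) ⊎ ((X ∈ᵇ Xs) ≡ false × heightAt ν X ≡ + (parity X + 2 * j′))
  ν-level X lt j′ e with X ∈ᵇ Xs | ν-height X (ℕP.<⇒≤ lt)
  ... | true  | h = inj₁ (refl , trans h (trans (cong (ℤ._+ + 2) e) (cong +_ (two-levels (parity X) j′))))
  ... | false | h = inj₂ (refl , trans h (trans (cong (ℤ._+ + 0) e) (ℤP.+-identityʳ _)))

  old∉new : ∀ {v} → ¬ (v ∈ ts × v ∈ map newTile Xs)
  old∉new (m₁ , m₂) with ∈P.∈-map⁻ newTile m₂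
  ... | X , _ , refl with InSkew-Z⁻ {k} (upper-dyck G) (upper-length G) (tiles-inSkew G m₁)
  ... | j , j′ , _ , eY , eμ , jj = ℕP.<-irrefl (level-injective (parity X) j j′ (ℤP.+-injective (trans (sym eY) eμ))) jj

  new-inSkew : ∀ {X} → X ∈ Xs → InSkew (Z k) ν (X , heightAt μ X)
  new-inSkew {X} m with μ-level X (Xs-bound m)
  ... | j′ , e with ν-level X (Xs-bound m) j′ e
  ... | inj₁ (_ , eν) = InSkew-Z⁺ {k} j′ (suc j′) (subst (X <_) (upper-length G) (Xs-bound m)) (ℕP.n<1+n j′) e eν
  ... | inj₂ (eq , _) with trans (sym (∈⇒∈ᵇ X Xs m)) eq
  ... | ()

  inSkew-ν : ∀ {v} → v ∈ ts ++ map newTile Xs → InSkew (Z k) ν (x v , y v)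
  inSkew-ν {v} m with ∈P.∈-++⁻ ts m
  ... | inj₂ m₂ with ∈P.∈-map⁻ newTile m₂
  ... | X , mX , refl = new-inSkew mX
  inSkew-ν {v} m | inj₁ m₁ with InSkew-Z⁻ {k} (upper-dyck G) (upper-length G) (tiles-inSkew G m₁)
  ... | j , j′ , lt , eY , eμ , jj with ν-level (x v) (subst (x v <_) (sym (upper-length G)) lt) j′ eμ
  ... | inj₁ (_ , eν) = InSkew-Z⁺ {k} j (suc j′) lt (ℕP.<-trans jj (ℕP.n<1+n j′)) eY eν
  ... | inj₂ (_ , eν) = InSkew-Z⁺ {k} j j′ lt jj eY eν

  cover-ν : ∀ X Y → InSkew (Z k) ν (X , Y) → tile X Y [] ∈ ts ++ map newTile Xs
  cover-ν X Y s with InSkew-Z⁻ {k} dyck-ν (trans length-ν (upper-length G)) s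
  ... | j , j″ , lt , eY , eν , jj with μ-level X (subst (X <_) (sym (upper-length G)) lt)
  ... | j′ , eμ with ν-level X (subst (X <_) (sym (upper-length G)) lt) j′ eμ
  ... | inj₂ (_ , eν′) with level-injective (parity X) j″ j′ (ℤP.+-injective (trans (sym eν) eν′))
  ... | refl = ∈P.∈-++⁺ˡ (tiles-cover G X Y (InSkew-Z⁺ {k} j j′ lt jj eY eμ))
  cover-ν X Y s | j , j″ , lt , eY , eν , jj | j′ , eμ | inj₁ (eq , eν′) with level-injective (parity X) j″ (suc j′) (ℤP.+-injective (trans (sym eν) eν′))
  ... | refl with ℕP.m≤n⇒m<n∨m≡n (ℕP.≤-pred jj)
  ... | inj₁ lt′ = ∈P.∈-++⁺ˡ (tiles-cover G X Y (InSkew-Z⁺ {k} j j′ lt lt′ eY eμ))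
  ... | inj₂ refl = ∈P.∈-++⁺ʳ ts (subst (_∈ map newTile Xs) (cong (λ h → tile X h []) (trans eμ (sym eY))) (∈P.∈-map⁺ newTile (∈ᵇ⇒∈ X Xs eq)))

  oneBoxZ-ν : OneBoxZ k (mkTiling (Z k) ν (ts ++ map newTile Xs))
  oneBoxZ-ν = record
    { lower≡Z = refl ; upper-dyck = dyck-ν ; upper-length = trans length-ν (upper-length G)
    ; tiles-unique = UniqueP.++⁺ (tiles-unique G) (UniqueP.map⁺ (cong x) Xs-unique) old∉new
    ; tiles-oneBox = AllP.++⁺ (tiles-oneBox G) (All.tabulate new-oneBox)
    ; tiles-inSkew = inSkew-ν ; tiles-cover = cover-ν }
    where
    new-oneBox : ∀ {v} → v ∈ map newTile Xs → IsOneBox v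
    new-oneBox m with ∈P.∈-map⁻ newTile m
    ... | _ , _ , refl = refl

addOnTop-OneBoxZ : ∀ k T Xs ν → OneBoxZ k T → Unique Xs → (∀ {X} → X ∈ Xs → X < length (upper T)) →
  Dyck ν → length ν ≡ length (upper T) →
  (∀ X → X ≤ length (upper T) → heightAt ν X ≡ heightAt (upper T) X ℤ.+ lift (X ∈ᵇ Xs)) →
  OneBoxZ k (addOnTop Xs T) × upper (addOnTop Xs T) ≡ ν
addOnTop-OneBoxZ k (mkTiling lo μ ts) Xs ν G uXs ltXs wν lν H with lower≡Z G
... | refl = subst (OneBoxZ k) (cong (λ u → mkTiling (Z k) u _) (sym raise≡ν)) oneBoxZ-ν , raise≡ν
  where open AddOnTop k μ ts G Xs ν uXs ltXs wν lν H

heightAt-offset : ∀ (ν μ : Path) (δ : ℕ → ℤ) → length ν ≡ length μ → δ 0 ≡ + 0 →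
  (∀ X → X < length μ → Δ (stepAt ν X) ℤ.+ δ X ≡ δ (suc X) ℤ.+ Δ (stepAt μ X)) →
  ∀ X → X ≤ length μ → heightAt ν X ≡ heightAt μ X ℤ.+ δ X
heightAt-offset ν μ δ l δ0 step zero    _  = sym (cong (λ z → + 0 ℤ.+ z) δ0)
heightAt-offset ν μ δ l δ0 step (suc X) lt = begin
  heightAt ν (suc X)                                 ≡⟨ heightAt-suc ν X (subst (X <_) (sym l) lt) ⟩
  heightAt ν X ℤ.+ Δ (stepAt ν X)                    ≡⟨ cong (ℤ._+ Δ (stepAt ν X)) (heightAt-offset ν μ δ l δ0 step X (ℕP.<⇒≤ lt)) ⟩
  heightAt μ X ℤ.+ δ X ℤ.+ Δ (stepAt ν X)            ≡⟨ reassoc₁ (heightAt μ X) (δ X) (Δ (stepAt ν X)) ⟩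
  heightAt μ X ℤ.+ (Δ (stepAt ν X) ℤ.+ δ X)          ≡⟨ cong (λ z → heightAt μ X ℤ.+ z) (step X lt) ⟩
  heightAt μ X ℤ.+ (δ (suc X) ℤ.+ Δ (stepAt μ X))    ≡⟨ reassoc₂ (heightAt μ X) (δ (suc X)) (Δ (stepAt μ X)) ⟩
  heightAt μ X ℤ.+ Δ (stepAt μ X) ℤ.+ δ (suc X)      ≡⟨ cong (ℤ._+ δ (suc X)) (sym (heightAt-suc μ X lt)) ⟩
  heightAt μ (suc X) ℤ.+ δ (suc X)                   ∎
  where
  open ≡-Reasoning
  reassoc₁ : ∀ (a d e : ℤ) → a ℤ.+ d ℤ.+ e ≡ a ℤ.+ (e ℤ.+ d)
  reassoc₁ = ℤ-solve
  reassoc₂ : ∀ (a d e : ℤ) → a ℤ.+ (d ℤ.+ e) ≡ a ℤ.+ e ℤ.+ d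
  reassoc₂ = ℤ-solve

step-offset : ∀ {c₁ b₁ b₂ c₂ c₁′ b₁′ b₂′ c₂′} → c₁ ≡ c₁′ → b₁ ≡ b₁′ → b₂ ≡ b₂′ → c₂ ≡ c₂′ →
  Δ c₁′ ℤ.+ lift b₁′ ≡ lift b₂′ ℤ.+ Δ c₂′ → Δ c₁ ℤ.+ lift b₁ ≡ lift b₂ ℤ.+ Δ c₂
step-offset refl refl refl refl e = e

Δ-lift-comm : ∀ c d → Δ c ℤ.+ lift d ≡ lift d ℤ.+ Δ c
Δ-lift-comm c d = ℤP.+-comm (Δ c) (lift d)

Δ-lift-swap : ∀ c d → Δ c ℤ.+ lift d ≡ lift c ℤ.+ Δ d
Δ-lift-swap true  true  = refl
Δ-lift-swap true  false = refl
Δ-lift-swap false true  = refl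
Δ-lift-swap false false = refl

stepAt-++ˡ : ∀ (A r : Path) X → X < length A → stepAt (A ++ r) X ≡ stepAt A X
stepAt-++ˡ (a ∷ A) r zero    _        = refl
stepAt-++ˡ (a ∷ A) r (suc X) (s≤s lt) = stepAt-++ˡ A r X lt

stepAt-++ʳ : ∀ (A r : Path) Y → stepAt (A ++ r) (length A + Y) ≡ stepAt r Y
stepAt-++ʳ []      r Y = refl
stepAt-++ʳ (a ∷ A) r Y = stepAt-++ʳ A r Y

stepAt-length-++ : ∀ (A r : Path) → stepAt (A ++ r) (length A) ≡ stepAt r 0
stepAt-length-++ A r = trans (cong (stepAt (A ++ r)) (sym (ℕP.+-identityʳ (length A)))) (stepAt-++ʳ A r 0)

stepAt-∷ʳ-down : ∀ (B : Path) j → stepAt (B ++ false ∷ []) j ≡ stepAt B j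
stepAt-∷ʳ-down []      zero    = refl
stepAt-∷ʳ-down []      (suc j) = refl
stepAt-∷ʳ-down (b ∷ B) zero    = refl
stepAt-∷ʳ-down (b ∷ B) (suc j) = stepAt-∷ʳ-down B j

stepAt-up⇒< : ∀ (B : Path) j → stepAt B j ≡ true → j < length B
stepAt-up⇒< (b ∷ B) zero    e = s≤s z≤n
stepAt-up⇒< (b ∷ B) (suc j) e = s≤s (stepAt-up⇒< B j e)

stepAt-elsewhere : ∀ (U V : Path) b b′ X → X ≢ length U → stepAt (U ++ b ∷ V) X ≡ stepAt (U ++ b′ ∷ V) X
stepAt-elsewhere []      V b b′ zero    ne = ⊥-elim (ne refl)
stepAt-elsewhere []      V b b′ (suc X) ne = refl
stepAt-elsewhere (u ∷ U) V b b′ zero    ne = refl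
stepAt-elsewhere (u ∷ U) V b b′ (suc X) ne = stepAt-elsewhere U V b b′ X (ne ∘ cong suc)

∈-filterᵇ-upTo⁺ : ∀ (p : ℕ → Bool) L {X} → X < L → p X ≡ true → X ∈ filterᵇ p (upTo L)
∈-filterᵇ-upTo⁺ p L lt e = ∈P.∈-filter⁺ (T? ∘ p) (∈P.∈-upTo⁺ lt) (Equivalence.from T-≡ e)

∈-filterᵇ-upTo⁻ : ∀ (p : ℕ → Bool) L {X} → X ∈ filterᵇ p (upTo L) → X < L × p X ≡ true
∈-filterᵇ-upTo⁻ p L m with ∈P.∈-filter⁻ (T? ∘ p) m
... | m′ , t = ∈P.∈-upTo⁻ m′ , Equivalence.to T-≡ t

∈ᵇ-filterᵇ-upTo : ∀ (p : ℕ → Bool) L X → (X ∈ᵇ filterᵇ p (upTo L)) ≡ ((X <ᵇ L) ∧ p X)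
∈ᵇ-filterᵇ-upTo p L X with X ∈ᵇ filterᵇ p (upTo L) in e | (X <ᵇ L) ∧ p X in e′
... | true  | true  = refl
... | false | false = refl
... | true  | false with ∈-filterᵇ-upTo⁻ p L (∈ᵇ⇒∈ X _ e)
...   | lt , pX with trans (sym e′) (cong₂ _∧_ (<ᵇ-true lt) pX)
...     | ()
∈ᵇ-filterᵇ-upTo p L X | false | true with X <ᵇ L in e₁ | p X in e₂
... | true | true with trans (sym (∈⇒∈ᵇ X _ (∈-filterᵇ-upTo⁺ p L (<ᵇ⇒< e₁) e₂))) e
...   | ()

Unique-filterᵇ-upTo : ∀ (p : ℕ → Bool) L → Unique (filterᵇ p (upTo L))
Unique-filterᵇ-upTo p L = UniqueP.filter⁺ (T? ∘ p) (UniqueP.upTo⁺ L)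

-- Strip-grow

data Side (S : ℕ) : ℕ → Set where
  left   : ∀ {X} → X < S → Side S X
  centre : Side S S
  right  : ∀ j → Side S (S + suc j)

side : ∀ S X → Side S X
side S X with ℕP.<-cmp X S
... | tri< lt _ _ = left lt
... | tri≈ _ refl _ = centre
... | tri> _ _ gt with ℕP.m≤n⇒∃[o]m+o≡n gt
... | j , refl = subst (Side S) (ℕP.+-suc S j) (right j)

module StripGrow (A B : Path) (wA : Dyck A) (wB : Dyck B) where
  S = length A
  μ = A ++ true ∷ false ∷ B
  ν = A ++ true ∷ (B ++ false ∷ [])
  L = length μ

  onUpStep : ℕ → Bool
  onUpStep X = (S + 1 ≤ᵇ X) ∧ stepAt μ X

  Xs = filterᵇ onUpStep (upTo L)

  raised : ℕ → Bool
  raised X = (X <ᵇ L) ∧ onUpStep X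

  length-ν : length ν ≡ L
  length-ν = trans (ListP.length-++ A) (trans (cong (λ z → S + suc z) (trans (ListP.length-++ B) (ℕP.+-comm (length B) 1)))
    (sym (ListP.length-++ A)))

  dyck-ν : Dyck ν
  dyck-ν = walk-++ wA (prime wB)

  raised-≤S : ∀ X → X ≤ S → raised X ≡ false
  raised-≤S X le rewrite ≤ᵇ-false {S + 1} {X} (ℕP.≤-<-trans le (subst (S <_) (ℕP.+-comm 1 S) (ℕP.n<1+n S))) = ∧-zeroʳ (X <ᵇ L)

  raised-right : ∀ j → raised (S + suc j) ≡ stepAt (false ∷ B) j
  raised-right j rewrite ≤ᵇ-true {S + 1} {S + suc j} (ℕP.+-monoʳ-≤ S (s≤s z≤n)) | stepAt-++ʳ A (true ∷ false ∷ B) (suc j)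
    with stepAt (false ∷ B) j in eq
  ... | false = ∧-zeroʳ _
  ... | true rewrite <ᵇ-true {S + suc j} {L} (subst (S + suc j <_) (sym (ListP.length-++ A))
          (ℕP.+-monoʳ-< S (s≤s (stepAt-up⇒< (false ∷ B) j eq)))) = refl

  raised-right′ : ∀ j → raised (suc (S + j)) ≡ stepAt (false ∷ B) j
  raised-right′ j = trans (cong raised (sym (ℕP.+-suc S j))) (raised-right j)

  -- ν is μ with the segment after the peak raised by one level: every up step of it carries a new box.
  step : ∀ X → X < L → Δ (stepAt ν X) ℤ.+ lift (raised X) ≡ lift (raised (suc X)) ℤ.+ Δ (stepAt μ X)
  step X _ with side S X
  ... | left lt = step-offset (stepAt-++ˡ A _ X lt) (raised-≤S X (ℕP.<⇒≤ lt)) (raised-≤S (suc X) lt) (stepAt-++ˡ A _ X lt)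
          (Δ-lift-comm (stepAt A X) false)
  ... | centre = step-offset (stepAt-length-++ A _) (raised-≤S S ℕP.≤-refl)
          (trans (cong (λ z → raised (suc z)) (sym (ℕP.+-identityʳ S))) (raised-right′ 0)) (stepAt-length-++ A _) refl
  ... | right j = step-offset (trans (stepAt-++ʳ A _ (suc j)) (stepAt-∷ʳ-down B j)) (raised-right j) (raised-right′ (suc j))
          (stepAt-++ʳ A _ (suc j)) (Δ-lift-swap (stepAt B j) (stepAt (false ∷ B) j))

  ν-height : ∀ X → X ≤ L → heightAt ν X ≡ heightAt μ X ℤ.+ lift (X ∈ᵇ Xs)
  ν-height X le = trans (heightAt-offset ν μ (lift ∘ raised) length-ν (cong lift (raised-≤S 0 z≤n)) step X le)
     (cong (λ b → heightAt μ X ℤ.+ lift b) (sym (∈ᵇ-filterᵇ-upTo onUpStep L X)))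

  Xs-bound : ∀ {X} → X ∈ Xs → X < L
  Xs-bound m = proj₁ (∈-filterᵇ-upTo⁻ onUpStep L m)

stripGrow-OneBoxZ : ∀ k T A B → OneBoxZ k T → upper T ≡ A ++ B → Dyck A →
  OneBoxZ (suc k) (stripGrow (length A) T) × upper (stripGrow (length A) T) ≡ A ++ true ∷ B ++ false ∷ []
stripGrow-OneBoxZ k T A B G eq wA with spread-OneBoxZ k T A B G eq wA
... | G′ , eq′ = grow (spread (length A) T) G′ eq′
  where
  open StripGrow A B wA (dyck-suffix (subst Dyck eq (upper-dyck G)) wA)
  grow : ∀ T′ → OneBoxZ (suc k) T′ → upper T′ ≡ μ →
    OneBoxZ (suc k) (addOnTop (filterᵇ (λ X → (S + 1 ≤ᵇ X) ∧ stepAt (upper T′) X) (upTo (length (upper T′)))) T′) ×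
    upper (addOnTop (filterᵇ (λ X → (S + 1 ≤ᵇ X) ∧ stepAt (upper T′) X) (upTo (length (upper T′)))) T′) ≡ ν
  grow (mkTiling lo .μ ts) G′ refl =
    addOnTop-OneBoxZ (suc k) (mkTiling lo μ ts) Xs ν G′ (Unique-filterᵇ-upTo onUpStep L) Xs-bound dyck-ν length-ν ν-height

-- Ribbon-grow

heightAt-raise-between : ∀ (ν μ : Path) a b → a < b → length ν ≡ length μ →
  stepAt ν a ≡ true → stepAt μ a ≡ false → stepAt ν b ≡ false → stepAt μ b ≡ true →
  (∀ X → X ≢ a → X ≢ b → stepAt ν X ≡ stepAt μ X) →
  ∀ X → X ≤ length μ → heightAt ν X ≡ heightAt μ X ℤ.+ lift ((a <ᵇ X) ∧ (X ≤ᵇ b))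
heightAt-raise-between ν μ a b a<b l νa μa νb μb same = heightAt-offset ν μ (lift ∘ inside) l refl step
  where
  inside : ℕ → Bool
  inside X = (a <ᵇ X) ∧ (X ≤ᵇ b)
  inside-lo : ∀ X → X ≤ a → inside X ≡ false
  inside-lo X le = cong (_∧ (X ≤ᵇ b)) (<ᵇ-false le)
  inside-mid : ∀ X → a < X → X ≤ b → inside X ≡ true
  inside-mid X lt le = cong₂ _∧_ (<ᵇ-true lt) (≤ᵇ-true le)
  inside-hi : ∀ X → b < X → inside X ≡ false
  inside-hi X lt = trans (cong ((a <ᵇ X) ∧_) (≤ᵇ-false lt)) (∧-zeroʳ (a <ᵇ X))
  step : ∀ X → X < length μ → Δ (stepAt ν X) ℤ.+ lift (inside X) ≡ lift (inside (suc X)) ℤ.+ Δ (stepAt μ X)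
  step X _ with ℕP.<-cmp X a
  ... | tri< x<a _ _ = step-offset (same X (ℕP.<⇒≢ x<a) (ℕP.<⇒≢ (ℕP.<-trans x<a a<b))) (inside-lo X (ℕP.<⇒≤ x<a))
          (inside-lo (suc X) x<a) (refl {x = stepAt μ X}) (Δ-lift-comm (stepAt μ X) false)
  ... | tri≈ _ refl _ = step-offset νa (inside-lo X ℕP.≤-refl) (inside-mid (suc X) (ℕP.n<1+n X) a<b) μa refl
  ... | tri> _ _ a<x with ℕP.<-cmp X b
  ... | tri< x<b _ _ = step-offset (same X (ℕP.>⇒≢ a<x) (ℕP.<⇒≢ x<b)) (inside-mid X a<x (ℕP.<⇒≤ x<b))
          (inside-mid (suc X) (ℕP.<-trans a<x (ℕP.n<1+n X)) x<b) (refl {x = stepAt μ X}) (Δ-lift-comm (stepAt μ X) true)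
  ... | tri≈ _ refl _ = step-offset νb (inside-mid X a<x ℕP.≤-refl) (inside-hi (suc X) (ℕP.n<1+n X)) μb refl
  ... | tri> _ _ b<x = step-offset (same X (ℕP.>⇒≢ a<x) (ℕP.>⇒≢ b<x))
          (inside-hi X b<x) (inside-hi (suc X) (ℕP.<-trans b<x (ℕP.n<1+n X))) (refl {x = stepAt μ X}) (Δ-lift-comm (stepAt μ X) false)

filterᵇ-∷ʳ : ∀ (p : ℕ → Bool) xs a → filterᵇ p (xs ∷ʳ a) ≡ filterᵇ p xs ++ (if p a then a ∷ [] else [])
filterᵇ-∷ʳ p [] a with p a
... | true  = refl
... | false = refl
filterᵇ-∷ʳ p (x ∷ xs) a with p x
... | true  = cong (x ∷_) (filterᵇ-∷ʳ p xs a)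
... | false = filterᵇ-∷ʳ p xs a

last-∷ʳ : ∀ (xs : List ℕ) a → last (xs ∷ʳ a) ≡ just a
last-∷ʳ []           a = refl
last-∷ʳ (x ∷ [])     a = refl
last-∷ʳ (x ∷ y ∷ xs) a = last-∷ʳ (y ∷ xs) a

last-filterᵇ-upTo : ∀ (p : ℕ → Bool) N Q → Q < N → p Q ≡ true → (∀ X → Q < X → X < N → p X ≡ false) →
  last (filterᵇ p (upTo N)) ≡ just Q
last-filterᵇ-upTo p (suc N) Q (s≤s le) pQ none =
  trans (cong (λ l → last (filterᵇ p l)) (sym (ListP.upTo-∷ʳ N))) (trans (cong last (filterᵇ-∷ʳ p (upTo N) N)) (with-last (p N) refl))
  where
  with-last : ∀ b → p N ≡ b → last (filterᵇ p (upTo N) ++ (if b then N ∷ [] else [])) ≡ just Q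
  with-last b e with ℕP.m≤n⇒m<n∨m≡n le
  ... | inj₂ refl = trans (cong (λ b → last (filterᵇ p (upTo N) ++ (if b then N ∷ [] else []))) (trans (sym e) pQ))
                      (last-∷ʳ (filterᵇ p (upTo N)) N)
  ... | inj₁ lt = trans (cong (λ b → last (filterᵇ p (upTo N) ++ (if b then N ∷ [] else []))) (trans (sym e) (none N lt (ℕP.n<1+n N))))
                    (trans (cong last (ListP.++-identityʳ (filterᵇ p (upTo N))))
                      (last-filterᵇ-upTo p N Q lt pQ (λ X q x → none X q (ℕP.<-trans x (ℕP.n<1+n N)))))

InSkew-Z-below : ∀ {k μ X c} → Dyck μ → length μ ≡ 2 * k → X < 2 * k → heightAt μ X ≡ + (c + 2) → InSkew (Z k) μ (X , + c)
InSkew-Z-below {k} {μ} {X} {c} w l lt e with walk-heightAt-parity w X (ℕP.<⇒≤ (subst (X <_) (sym l) lt))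
... | zero , e′ = ⊥-elim (ℕP.<⇒≱ (s≤s (s≤s z≤n)) (subst (_≤ 1) (sym (ℕP.+-comm 2 c))
                    (subst (_≤ 1) (sym (trans (ℤP.+-injective (trans (sym e) (trans (sym (ℤP.+-identityˡ _)) e′))) (ℕP.+-identityʳ _))) (parity≤1 X))))
... | suc j , e′ = InSkew-Z⁺ {k} {μ} j (suc j) lt (ℕP.n<1+n j) (cong +_ c≡) (trans e (cong +_ (trans (cong (_+ 2) c≡) (two-levels (parity X) j))))
  where
  c≡ : c ≡ parity X + 2 * j
  c≡ = ℕP.+-cancelʳ-≡ 2 c (parity X + 2 * j)
         (trans (ℤP.+-injective (trans (sym e) (trans (sym (ℤP.+-identityˡ _)) e′))) (sym (two-levels (parity X) j)))

-- For μ = P U C D, the special column is the top of that last U: every later up step ends on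
-- top of a box, while the point at height 1 cannot be.
module Special (k : ℕ) (P C : Path) (ts : List Tile) (G : OneBoxZ k (mkTiling (Z k) (P ++ true ∷ C ++ false ∷ []) ts))
   (wP : Dyck P) (wC : Dyck C) where
  μ = P ++ true ∷ C ++ false ∷ []
  T = mkTiling (Z k) μ ts
  Q = length P + 1
  L = length μ

  length-μ : L ≡ length P + suc (length C + 1)
  length-μ = trans (ListP.length-++ P) (cong (λ z → length P + suc z) (ListP.length-++ C))

  μ-at-Q : heightAt μ Q ≡ + 1
  μ-at-Q = trans (heightAt-++ʳ P (true ∷ C ++ false ∷ []) 1) (cong (ℤ._+ + 1) (dyck-hgt wP))

  no-top-at-Q : ∀ {t} → t ∈ ts → isOneBoxTopAt Q (+ 1) t ≡ false
  no-top-at-Q {t} m with All.lookup (tiles-oneBox G) m | InSkew-Z⁻ {k} (upper-dyck G) (upper-length G) (tiles-inSkew G m)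
  no-top-at-Q {tile a b .[]} m | refl | j , _ , _ , refl , _ =
    trans (cong ((a ≡ᵇ Q) ∧_) (⌊⌋-false (+ (parity a + 2 * j) ℤ.+ + 2 ℤ.≟ + 1) (λ e → ≢1 (ℤP.+-injective e)))) (∧-zeroʳ _)
    where
    ≢1 : parity a + 2 * j + 2 ≢ 1
    ≢1 e = ℕP.<-irrefl (sym e) (subst (1 <_) (sym (ℕP.+-comm (parity a + 2 * j) 2)) (s≤s (s≤s z≤n)))

  eligible-Q : eligible T Q ≡ true
  eligible-Q rewrite ≤ᵇ-true {1} {Q} (subst (1 ≤_) (ℕP.+-comm 1 (length P)) (s≤s z≤n))
        | ℕP.m+n∸n≡m (length P) 1
        | stepAt-length-++ P (true ∷ C ++ false ∷ [])
        | μ-at-Q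
        | any-false (isOneBoxTopAt Q (+ 1)) ts no-top-at-Q = refl

  regroup : ∀ p j → p + 1 + suc j ≡ p + (2 + j)
  regroup = ℕ-solve

  step-before : ∀ j → stepAt μ (Q + suc j ∸ 1) ≡ stepAt C j
  step-before j = trans (cong (λ X → stepAt μ (X ∸ 1)) (shift (length P) j)) (trans (stepAt-++ʳ P _ (suc j)) (stepAt-∷ʳ-down C j))
    where
    shift : ∀ p j → p + 1 + suc j ≡ suc (p + suc j)
    shift = ℕ-solve

  covered-at : ℕ → Bool
  covered-at X = any (isOneBoxTopAt X (heightAt μ X)) ts

  ineligible-after-Q : ∀ j → Q + suc j < suc L → eligible T (Q + suc j) ≡ false
  ineligible-after-Q j _ with stepAt C j in step-j
  ... | false = trans (cong ((1 ≤ᵇ Q + suc j) ∧_) (cong (_∧ not (covered-at (Q + suc j))) (trans (step-before j) step-j))) (∧-zeroʳ _)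
  ... | true with walk-heightAt wC j
  ... | c , c≡ = trans (cong ((1 ≤ᵇ Q + suc j) ∧_) (cong₂ _∧_ (trans (step-before j) step-j) (cong not covered))) (∧-zeroʳ _)
    where
    j<C : j < length C
    j<C = stepAt-up⇒< C j step-j
    μ-at-X : heightAt μ (Q + suc j) ≡ + (c + 2)
    μ-at-X = begin
      heightAt μ (Q + suc j)                                ≡⟨ cong (heightAt μ) (regroup (length P) j) ⟩
      heightAt μ (length P + (2 + j))                       ≡⟨ heightAt-++ʳ P _ (2 + j) ⟩
      hgt P ℤ.+ (+ 1 ℤ.+ heightAt (C ++ false ∷ []) (suc j)) ≡⟨ trans (cong (ℤ._+ _) (dyck-hgt wP)) (ℤP.+-identityˡ _) ⟩
      + 1 ℤ.+ heightAt (C ++ false ∷ []) (suc j)            ≡⟨ cong (λ z → + 1 ℤ.+ z) (heightAt-++ˡ (suc j) C _ j<C) ⟩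
      + 1 ℤ.+ heightAt C (suc j)                            ≡⟨ cong (λ z → + 1 ℤ.+ z) (heightAt-suc C j j<C) ⟩
      + 1 ℤ.+ (heightAt C j ℤ.+ Δ (stepAt C j))             ≡⟨ cong (λ z → + 1 ℤ.+ (z ℤ.+ Δ (stepAt C j))) c≡ ⟩
      + 1 ℤ.+ (+ c ℤ.+ Δ (stepAt C j))                      ≡⟨ cong (λ b → + 1 ℤ.+ (+ c ℤ.+ Δ b)) step-j ⟩
      + (1 + (c + 1))                                       ≡⟨ cong +_ (regroup-height c) ⟩
      + (c + 2)                                             ∎
      where
      open ≡-Reasoning
      regroup-height : ∀ c → 1 + (c + 1) ≡ c + 2
      regroup-height = ℕ-solve
    X<2k : Q + suc j < 2 * k
    X<2k = subst₂ _<_ (sym (regroup (length P) j)) (trans (sym length-μ) (upper-length G))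
             (ℕP.+-monoʳ-< (length P) (s≤s (subst (suc j <_) (ℕP.+-comm 1 (length C)) (s≤s j<C))))
    covered : covered-at (Q + suc j) ≡ true
    covered = any-true (isOneBoxTopAt (Q + suc j) (heightAt μ (Q + suc j))) ts
      (tiles-cover G (Q + suc j) (+ c) (InSkew-Z-below {k} (upper-dyck G) (upper-length G) X<2k μ-at-X))
      (cong₂ _∧_ (≡ᵇ-refl (Q + suc j)) (⌊⌋-true (+ c ℤ.+ + 2 ℤ.≟ heightAt μ (Q + suc j)) (sym μ-at-X)))

  special≡Q : special T ≡ just Q
  special≡Q = last-filterᵇ-upTo (eligible T) (suc L) Q (s≤s (subst (Q ≤_) (sym length-μ) (ℕP.+-monoʳ-≤ (length P) (s≤s z≤n))))
    eligible-Q ineligible-beyond-Q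
    where
    ineligible-beyond-Q : ∀ X → Q < X → X < suc L → eligible T X ≡ false
    ineligible-beyond-Q X Q<X X<L with ℕP.m≤n⇒∃[o]m+o≡n Q<X
    ... | j , refl = subst (λ X → eligible T X ≡ false) (ℕP.+-suc Q j) (ineligible-after-Q j (subst (_< suc L) (sym (ℕP.+-suc Q j)) X<L))

special-last-return : ∀ k T P C → OneBoxZ k T → upper T ≡ P ++ true ∷ C ++ false ∷ [] → Dyck P → Dyck C →
  special T ≡ just (length P + 1)
special-last-return k (mkTiling lo μ ts) P C G refl wP wC with lower≡Z G
... | refl = Special.special≡Q k P C ts G wP wC

ribbonGrow-special : ∀ S T Q → special (spread S T) ≡ just Q →
  ribbonGrow S T ≡ (if S + 1 <ᵇ Q then addOnTop (filterᵇ (λ X → (S + 1 <ᵇ X) ∧ (X <ᵇ Q)) (upTo Q)) (spread S T) else spread S T)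
ribbonGrow-special S T Q e rewrite e = refl

ribbonGrow-OneBoxZ-[] : ∀ k T A → OneBoxZ k T → upper T ≡ A ++ [] → Dyck A →
  OneBoxZ (suc k) (ribbonGrow (length A) T) × upper (ribbonGrow (length A) T) ≡ A ++ true ∷ false ∷ []
ribbonGrow-OneBoxZ-[] k T A G eq wA with spread-OneBoxZ k T A [] G eq wA
... | G′ , eq′ rewrite ribbonGrow-special (length A) T (length A + 1) (special-last-return (suc k) (spread (length A) T) A [] G′ eq′ wA stop)
                     | <ᵇ-false {length A + 1} {length A + 1} ℕP.≤-refl = G′ , eq′

-- Ribbon-grow on A ++ B′ U C D: after spreading, the ribbon fills the columns strictly between the new peak and the
-- last return, which turns A U D B′ U C D into A U U B′ D C D.
module RibbonGrow (A B′ C : Path) (wA : Dyck A) (wB′ : Dyck B′) (wC : Dyck C) where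
  R = C ++ false ∷ []
  S = length A

  path : Bool → Bool → Path
  path y z = A ++ true ∷ y ∷ B′ ++ z ∷ R

  ν = path true false
  μ = path false true
  P = A ++ true ∷ false ∷ B′
  Q = length P + 1
  a = length (A ++ true ∷ [])
  b = length P

  inRibbon : ℕ → Bool
  inRibbon X = (S + 1 <ᵇ X) ∧ (X <ᵇ Q)

  Xs = filterᵇ inRibbon (upTo Q)

  path-at-a : ∀ y z → path y z ≡ (A ++ true ∷ []) ++ y ∷ (B′ ++ z ∷ R)
  path-at-a y z = sym (ListP.++-assoc A (true ∷ []) _)

  path-at-b : ∀ y z → path y z ≡ (A ++ true ∷ y ∷ B′) ++ z ∷ R
  path-at-b y z = sym (ListP.++-assoc A (true ∷ y ∷ B′) (z ∷ R))

  length-at-b : ∀ y → length (A ++ true ∷ y ∷ B′) ≡ b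
  length-at-b y = trans (ListP.length-++ A) (sym (ListP.length-++ A))

  stepAt-a : ∀ y z → stepAt (path y z) a ≡ y
  stepAt-a y z = trans (cong (λ l → stepAt l a) (path-at-a y z)) (stepAt-length-++ (A ++ true ∷ []) _)

  stepAt-b : ∀ y z → stepAt (path y z) b ≡ z
  stepAt-b y z = trans (cong (λ l → stepAt l b) (path-at-b y z))
    (trans (cong (stepAt ((A ++ true ∷ y ∷ B′) ++ z ∷ R)) (sym (length-at-b y))) (stepAt-length-++ (A ++ true ∷ y ∷ B′) _))

  stepAt-elsewhere-ν-μ : ∀ X → X ≢ a → X ≢ b → stepAt ν X ≡ stepAt μ X
  stepAt-elsewhere-ν-μ X ≢a ≢b = begin
    stepAt ν X                                           ≡⟨ cong (λ l → stepAt l X) (path-at-a true false) ⟩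
    stepAt ((A ++ true ∷ []) ++ true ∷ B′ ++ false ∷ R) X  ≡⟨ stepAt-elsewhere (A ++ true ∷ []) (B′ ++ false ∷ R) true false X ≢a ⟩
    stepAt ((A ++ true ∷ []) ++ false ∷ B′ ++ false ∷ R) X ≡⟨ cong (λ l → stepAt l X) (trans (sym (path-at-a false false)) (path-at-b false false)) ⟩
    stepAt ((A ++ true ∷ false ∷ B′) ++ false ∷ R) X       ≡⟨ stepAt-elsewhere (A ++ true ∷ false ∷ B′) R false true X ≢b ⟩
    stepAt ((A ++ true ∷ false ∷ B′) ++ true ∷ R) X        ≡⟨ cong (λ l → stepAt l X) (sym (path-at-b false true)) ⟩
    stepAt μ X                                           ∎
    where open ≡-Reasoning

  a<b : a < b
  a<b = subst₂ _<_ (sym (ListP.length-++ A)) (sym (ListP.length-++ A)) (ℕP.+-monoʳ-< S (s≤s (s≤s z≤n)))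

  length-ν : length ν ≡ length μ
  length-ν = trans (ListP.length-++ A) (trans (cong (λ z → S + suc (suc z)) (trans (ListP.length-++ B′) (sym (ListP.length-++ B′))))
    (sym (ListP.length-++ A)))

  dyck-ν : Dyck ν
  dyck-ν = walk-++ wA (up (up (walk-++ (walk-lift (walk-lift wB′)) (down (walk-++ (walk-lift wC) (down stop))))))

  ∈ᵇ-Xs : ∀ X → (X ∈ᵇ Xs) ≡ ((a <ᵇ X) ∧ (X ≤ᵇ b))
  ∈ᵇ-Xs X = begin
    X ∈ᵇ Xs                              ≡⟨ ∈ᵇ-filterᵇ-upTo inRibbon Q X ⟩
    (X <ᵇ Q) ∧ ((S + 1 <ᵇ X) ∧ (X <ᵇ Q)) ≡⟨ absorb (X <ᵇ Q) (S + 1 <ᵇ X) ⟩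
    (S + 1 <ᵇ X) ∧ (X <ᵇ Q)              ≡⟨ cong₂ _∧_ (cong (_<ᵇ X) (sym (ListP.length-++ A))) (trans (cong (X <ᵇ_) (ℕP.+-comm b 1)) (≤ᵇ-as-<ᵇ X)) ⟩
    (a <ᵇ X) ∧ (X ≤ᵇ b)                  ∎
    where
    open ≡-Reasoning
    ≤ᵇ-as-<ᵇ : ∀ X → (X <ᵇ suc b) ≡ (X ≤ᵇ b)
    ≤ᵇ-as-<ᵇ zero    = refl
    ≤ᵇ-as-<ᵇ (suc X) = refl
    absorb : ∀ c d → c ∧ (d ∧ c) ≡ d ∧ c
    absorb true  d = refl
    absorb false d = sym (∧-zeroʳ d)

  ν-height : ∀ X → X ≤ length μ → heightAt ν X ≡ heightAt μ X ℤ.+ lift (X ∈ᵇ Xs)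
  ν-height X le = trans (heightAt-raise-between ν μ a b a<b length-ν (stepAt-a true false) (stepAt-a false true)
                          (stepAt-b true false) (stepAt-b false true) stepAt-elsewhere-ν-μ X le)
     (cong (λ c → heightAt μ X ℤ.+ lift c) (sym (∈ᵇ-Xs X)))

  Xs-bound : ∀ {X} → X ∈ Xs → X < length μ
  Xs-bound {X} m = ℕP.<-≤-trans (proj₁ (∈-filterᵇ-upTo⁻ inRibbon Q m))
    (subst (Q ≤_) (sym (trans (cong length (path-at-b false true)) (ListP.length-++ (A ++ true ∷ false ∷ B′))))
      (subst (_≤ length (A ++ true ∷ false ∷ B′) + suc (length R)) (cong (_+ 1) (length-at-b false)) (ℕP.+-monoʳ-≤ _ (s≤s z≤n))))

  grow : ∀ {k} T → OneBoxZ (suc k) T → upper T ≡ μ → OneBoxZ (suc k) (addOnTop Xs T) × upper (addOnTop Xs T) ≡ ν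
  grow {k} (mkTiling lo .μ ts) G refl =
    addOnTop-OneBoxZ (suc k) (mkTiling lo μ ts) Xs ν G (Unique-filterᵇ-upTo inRibbon Q) Xs-bound dyck-ν length-ν ν-height

ribbonGrow-OneBoxZ-∷ : ∀ k T A B′ C → OneBoxZ k T → upper T ≡ A ++ B′ ++ true ∷ C ++ false ∷ [] → Dyck A → Dyck B′ → Dyck C →
  OneBoxZ (suc k) (ribbonGrow (length A) T) × upper (ribbonGrow (length A) T) ≡ A ++ true ∷ true ∷ B′ ++ false ∷ C ++ false ∷ []
ribbonGrow-OneBoxZ-∷ k T A B′ C G eq wA wB′ wC with spread-OneBoxZ k T A (B′ ++ true ∷ C ++ false ∷ []) G eq wA
... | G′ , eq′ rewrite ribbonGrow-special (length A) T (length (A ++ true ∷ false ∷ B′) + 1)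
                         (special-last-return (suc k) (spread (length A) T) (A ++ true ∷ false ∷ B′) C G′
                           (trans eq′ (sym (ListP.++-assoc A (true ∷ false ∷ B′) _))) (walk-++ wA (up (down wB′))) wC)
                     | <ᵇ-true {length A + 1} {length (A ++ true ∷ false ∷ B′) + 1}
                         (ℕP.+-monoˡ-< 1 (subst (length A <_) (sym (ListP.length-++ A)) (ℕP.m<m+n (length A) (s≤s z≤n))))
  = RibbonGrow.grow A B′ C wA wB′ wC (spread (length A) T) G′ eq′

-- 231-avoiding permutations

-- No231From x ys: no pattern 231 in x ∷ ys uses x as its "2".
No231From : ℕ → List ℕ → Set
No231From x []       = ⊤
No231From x (y ∷ ys) = (x < y → All (λ c → ¬ c < x) ys) × No231From x ys

Avoids231′ : List ℕ → Set
Avoids231′ []       = ⊤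
Avoids231′ (x ∷ xs) = No231From x xs × Avoids231′ xs

lookup⇒All : ∀ {P : ℕ → Set} ys → ((i : Fin (length ys)) → P (lookup ys i)) → All P ys
lookup⇒All []       h = []
lookup⇒All (y ∷ ys) h = h Fin.zero ∷ lookup⇒All ys (h ∘ Fin.suc)

No231From⇒ : ∀ x ys → No231From x ys → ∀ (j k : Fin (length ys)) → j Fin.< k → ¬ (lookup ys k < x × x < lookup ys j)
No231From⇒ x (y ∷ ys) nx Fin.zero    Fin.zero    ()       _
No231From⇒ x (y ∷ ys) nx Fin.zero    (Fin.suc k) _        (c , d) = All.lookup (proj₁ nx d) (∈P.∈-lookup k) c
No231From⇒ x (y ∷ ys) nx (Fin.suc j) Fin.zero    ()       _
No231From⇒ x (y ∷ ys) nx (Fin.suc j) (Fin.suc k) (s≤s lt) = No231From⇒ x ys (proj₂ nx) j k lt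

⇒No231From : ∀ x ys → (∀ (j k : Fin (length ys)) → j Fin.< k → ¬ (lookup ys k < x × x < lookup ys j)) → No231From x ys
⇒No231From x []       h = tt
⇒No231From x (y ∷ ys) h = (λ d → lookup⇒All ys (λ k c → h Fin.zero (Fin.suc k) (s≤s z≤n) (c , d))) ,
                          ⇒No231From x ys (λ j k lt → h (Fin.suc j) (Fin.suc k) (s≤s lt))

Avoids231′⇒Avoids231 : ∀ σ → Avoids231′ σ → Avoids231 σ
Avoids231′⇒Avoids231 (x ∷ xs) (nx , av) Fin.zero    Fin.zero    k           ()       _
Avoids231′⇒Avoids231 (x ∷ xs) (nx , av) Fin.zero    (Fin.suc j) Fin.zero    _        ()
Avoids231′⇒Avoids231 (x ∷ xs) (nx , av) Fin.zero    (Fin.suc j) (Fin.suc k) _        (s≤s jk) = No231From⇒ x xs nx j k jk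
Avoids231′⇒Avoids231 (x ∷ xs) (nx , av) (Fin.suc i) Fin.zero    k           ()       _
Avoids231′⇒Avoids231 (x ∷ xs) (nx , av) (Fin.suc i) (Fin.suc j) Fin.zero    _        ()
Avoids231′⇒Avoids231 (x ∷ xs) (nx , av) (Fin.suc i) (Fin.suc j) (Fin.suc k) (s≤s ij) (s≤s jk) = Avoids231′⇒Avoids231 xs av i j k ij jk

Avoids231⇒Avoids231′ : ∀ σ → Avoids231 σ → Avoids231′ σ
Avoids231⇒Avoids231′ []       h = tt
Avoids231⇒Avoids231′ (x ∷ xs) h = ⇒No231From x xs (λ j k lt → h Fin.zero (Fin.suc j) (Fin.suc k) (s≤s z≤n) (s≤s lt)) ,
                                  Avoids231⇒Avoids231′ xs (λ i j k a b → h (Fin.suc i) (Fin.suc j) (Fin.suc k) (s≤s a) (s≤s b))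

No231From-delete : ∀ x zs {n β} → No231From x (zs ++ n ∷ β) → No231From x (zs ++ β)
No231From-delete x []       (_ , nx) = nx
No231From-delete x (z ∷ zs) (f , nx) = (λ d → All-delete zs (f d)) , No231From-delete x zs nx

No231From-past : ∀ x zs {n β} → No231From x (zs ++ n ∷ β) → x < n → All (λ c → ¬ c < x) β
No231From-past x []       (f , _)  d = f d
No231From-past x (z ∷ zs) (_ , nx) d = No231From-past x zs nx d

No231From-insert : ∀ x zs {n β} → No231From x (zs ++ β) → ¬ n < x → All (λ c → ¬ c < x) β → No231From x (zs ++ n ∷ β)
No231From-insert x []       nx       nn aβ = (λ _ → aβ) , nx
No231From-insert x (z ∷ zs) (f , nx) nn aβ = (λ d → All-insert zs nn (f d)) , No231From-insert x zs nx nn aβ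

No231From-max : ∀ n β → All (_< n) β → No231From n β
No231From-max n []      _        = tt
No231From-max n (y ∷ β) (lt ∷ a) = (λ d → ⊥-elim (ℕP.<-asym lt d)) , No231From-max n β a

Avoids231′-delete : ∀ α {n β} → Avoids231′ (α ++ n ∷ β) → Avoids231′ (α ++ β)
Avoids231′-delete []      (_ , av)  = av
Avoids231′-delete (a ∷ α) (nx , av) = No231From-delete a α nx , Avoids231′-delete α av

Below : List ℕ → List ℕ → Set
Below α β = All (λ a → All (a <_) β) α

Avoids231′-max⇒Below : ∀ α {n β} → Avoids231′ (α ++ n ∷ β) → All (_< n) α → Unique (α ++ β) → Below α β
Avoids231′-max⇒Below []      _         _         _        = []
Avoids231′-max⇒Below (a ∷ α) {n} {β} (nx , av) (an ∷ aα) (ua ∷ u) =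
  All.tabulate (λ {b} m → a<b b m) ∷ Avoids231′-max⇒Below α av aα u
  where
  a<b : ∀ b → b ∈ β → a < b
  a<b b m with ℕP.<-cmp a b
  ... | tri< lt _ _    = lt
  ... | tri≈ _ refl _ = ⊥-elim (All.lookup ua (∈P.∈-++⁺ʳ α m) refl)
  ... | tri> _ _ gt    = ⊥-elim (All.lookup (No231From-past a α nx an) m gt)

Avoids231′-insert-max : ∀ α {n β} → Avoids231′ (α ++ β) → Below α β → All (_< n) (α ++ β) → Avoids231′ (α ++ n ∷ β)
Avoids231′-insert-max []      {n} {β} av        _          an         = No231From-max n β an , av
Avoids231′-insert-max (a ∷ α) {n} {β} (nx , av) (aβ ∷ lt) (an ∷ aαn) =
  No231From-insert a α nx (ℕP.<-asym an) (All.map (λ ac ca → ℕP.<-asym ac ca) aβ) , Avoids231′-insert-max α av lt aαn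

oneTo : ℕ → List ℕ
oneTo m = map suc (upTo m)

oneTo-suc : ∀ m → oneTo (suc m) ≡ oneTo m ∷ʳ suc m
oneTo-suc m = trans (cong (map suc) (sym (ListP.upTo-∷ʳ m))) (ListP.map-++ suc (upTo m) (m ∷ []))

Unique-oneTo : ∀ m → Unique (oneTo m)
Unique-oneTo m = UniqueP.map⁺ ℕP.suc-injective (UniqueP.upTo⁺ m)

∈-oneTo⁻ : ∀ {m x} → x ∈ oneTo m → x ≤ m
∈-oneTo⁻ m with ∈P.∈-map⁻ suc m
... | i , mi , refl = ∈P.∈-upTo⁻ mi

length-oneTo : ∀ m → length (oneTo m) ≡ m
length-oneTo m = trans (ListP.length-map suc (upTo m)) (ListP.length-upTo m)

IsPerm-length : ∀ {m σ} → IsPerm m σ → length σ ≡ m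
IsPerm-length {m} p = trans (↭P.↭-length p) (length-oneTo m)

IsPerm-∈ : ∀ {m σ x} → IsPerm m σ → x ∈ σ → x ≤ m
IsPerm-∈ p mx = ∈-oneTo⁻ (↭P.∈-resp-↭ p mx)

IsPerm-unique : ∀ {m σ} → IsPerm m σ → Unique σ
IsPerm-unique {m} p = ↭ₛP.Unique-resp-↭ (setoid ℕ) (↭⇒↭ₛ (↭-sym p)) (Unique-oneTo m)

IsPerm-++-length : ∀ {m} α β → IsPerm m (α ++ β) → length α + length β ≡ m
IsPerm-++-length α β p = trans (sym (ListP.length-++ α)) (IsPerm-length p)

Below-max : ∀ {m} α β → IsPerm m (α ++ β) → m ∈ α → Below α β → β ≡ []
Below-max α []      _ _   _     = refl
Below-max α (b ∷ β) p m∈α below =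
  ⊥-elim (ℕP.<⇒≱ (All.lookup (All.lookup below m∈α) (here refl)) (IsPerm-∈ p (∈P.∈-++⁺ʳ α (here refl))))

IsPerm-insert-max : ∀ m α β → IsPerm m (α ++ β) → IsPerm (suc m) (α ++ suc m ∷ β)
IsPerm-insert-max m α β p = begin
  α ++ suc m ∷ β        ↭⟨ ↭P.shift (suc m) α β ⟩
  suc m ∷ α ++ β        ↭⟨ prep (suc m) p ⟩
  suc m ∷ oneTo m       ≡⟨ cong (suc m ∷_) (sym (ListP.++-identityʳ (oneTo m))) ⟩
  suc m ∷ oneTo m ++ [] ↭⟨ ↭-sym (↭P.shift (suc m) (oneTo m) []) ⟩
  oneTo m ++ suc m ∷ [] ≡⟨ sym (oneTo-suc m) ⟩
  oneTo (suc m)         ∎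
  where open PermutationReasoning

IsPerm-delete-max : ∀ m α β → IsPerm (suc m) (α ++ suc m ∷ β) → IsPerm m (α ++ β)
IsPerm-delete-max m α β p = ↭P.drop-∷ (begin
  suc m ∷ α ++ β         ↭⟨ ↭-sym (↭P.shift (suc m) α β) ⟩
  α ++ suc m ∷ β         ↭⟨ p ⟩
  oneTo (suc m)          ≡⟨ oneTo-suc m ⟩
  oneTo m ++ suc m ∷ []  ↭⟨ ↭P.shift (suc m) (oneTo m) [] ⟩
  suc m ∷ oneTo m ++ []  ≡⟨ cong (suc m ∷_) (ListP.++-identityʳ (oneTo m)) ⟩
  suc m ∷ oneTo m        ∎)
  where open PermutationReasoning

Perm231-split-max : ∀ m σ → Perm231 (suc m) σ →
  Σ (List ℕ) λ α → Σ (List ℕ) λ β → (σ ≡ α ++ suc m ∷ β) × Perm231 m (α ++ β) × Below α β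
Perm231-split-max m σ (p , av)
  with ∈P.∈-∃++ (↭P.∈-resp-↭ (↭-sym p) (subst (suc m ∈_) (sym (oneTo-suc m)) (∈P.∈-++⁺ʳ (oneTo m) (here refl))))
... | α , β , refl =
  α , β , refl , (pτ , Avoids231′⇒Avoids231 (α ++ β) (Avoids231′-delete α av′)) ,
  Avoids231′-max⇒Below α av′ (All.tabulate (λ mx → s≤s (IsPerm-∈ pτ (∈P.∈-++⁺ˡ mx)))) (IsPerm-unique pτ)
  where
  pτ : IsPerm m (α ++ β)
  pτ = IsPerm-delete-max m α β p
  av′ : Avoids231′ (α ++ suc m ∷ β)
  av′ = Avoids231⇒Avoids231′ _ av

Perm231-insert-max : ∀ m α β → Perm231 m (α ++ β) → Below α β → Perm231 (suc m) (α ++ suc m ∷ β)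
Perm231-insert-max m α β (p , av) lt =
  IsPerm-insert-max m α β p ,
  Avoids231′⇒Avoids231 _ (Avoids231′-insert-max α (Avoids231⇒Avoids231′ _ av) lt (All.tabulate (λ mx → s≤s (IsPerm-∈ p mx))))

-- The sequence of a labeled tree on the zig-zag path

posOf-< : ∀ {i s} → i ∈ s → posOf i s < length s
posOf-< {i} {a ∷ s} (here refl) rewrite ≡ᵇ-refl i = s≤s z≤n
posOf-< {i} {a ∷ s} (there m) with a ≡ᵇ i
... | true  = s≤s z≤n
... | false = s≤s (posOf-< m)

posOf-++-∈ : ∀ {i} α β → i ∈ α → posOf i (α ++ β) ≡ posOf i α
posOf-++-∈ {i} (a ∷ α) β m with a ≡ᵇ i in eq | m
... | true  | _         = refl
... | false | here refl with trans (sym (≡ᵇ-refl i)) eq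
...   | ()
posOf-++-∈ (a ∷ α) β m | false | there m′ = cong suc (posOf-++-∈ α β m′)

posOf-++-∉ : ∀ {i} α β → i ∉ α → posOf i (α ++ β) ≡ length α + posOf i β
posOf-++-∉ []          β nm = refl
posOf-++-∉ {i} (a ∷ α) β nm rewrite ≡ᵇ-false {a} {i} (λ e → nm (here (sym e))) = cong suc (posOf-++-∉ α β (nm ∘ there))

shiftPos : ℕ → ℕ → ℕ
shiftPos a p = if p <ᵇ a then p else suc p

posOf-insert : ∀ α {n β i} → n ≢ i → posOf i (α ++ n ∷ β) ≡ shiftPos (length α) (posOf i (α ++ β))
posOf-insert []      {n} {β} {i} ne rewrite ≡ᵇ-false ne = refl
posOf-insert (a ∷ α) {n} {β} {i} ne with a ≡ᵇ i
... | true  = refl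
... | false rewrite posOf-insert α {n} {β} {i} ne with posOf i (α ++ β) <ᵇ length α
... | true  = refl
... | false = refl

posOf-inserted : ∀ α {n β} → n ∉ α → posOf n (α ++ n ∷ β) ≡ length α
posOf-inserted []      {n} nm rewrite ≡ᵇ-refl n = refl
posOf-inserted (a ∷ α) {n} nm rewrite ≡ᵇ-false {a} {n} (λ e → nm (here (sym e))) = cong suc (posOf-inserted α (nm ∘ there))

<ᵇ-cong-⇔ : ∀ {m n m′ n′} → (m < n → m′ < n′) → (m′ < n′ → m < n) → (m <ᵇ n) ≡ (m′ <ᵇ n′)
<ᵇ-cong-⇔ {m} {n} {m′} {n′} f g with m <ᵇ n in e₁ | m′ <ᵇ n′ in e₂
... | true  | true  = refl
... | false | false = refl
... | true  | false = ⊥-elim (ℕP.<⇒≱ (f (<ᵇ⇒< e₁)) (<ᵇ-false⇒≥ e₂))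
... | false | true  = ⊥-elim (ℕP.<⇒≱ (g (<ᵇ⇒< e₂)) (<ᵇ-false⇒≥ e₁))

shiftPos-<ᵇ : ∀ a q p → (shiftPos a q <ᵇ shiftPos a p) ≡ (q <ᵇ p)
shiftPos-<ᵇ a q p with q <ᵇ a in e₁ | p <ᵇ a in e₂
... | true  | true  = refl
... | false | false = refl
... | true  | false = <ᵇ-cong-⇔ (λ _ → ℕP.<-≤-trans (<ᵇ⇒< {q} {a} e₁) (<ᵇ-false⇒≥ {p} {a} e₂)) (λ lt → ℕP.<-trans lt (ℕP.n<1+n p))
... | false | true  = <ᵇ-cong-⇔ (ℕP.<-trans (ℕP.n<1+n q))
                        (λ lt → ⊥-elim (ℕP.<-asym lt (ℕP.<-≤-trans (<ᵇ⇒< {p} {a} e₂) (<ᵇ-false⇒≥ {q} {a} e₁))))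

shiftPos-<ᵇ-a : ∀ a q → (shiftPos a q <ᵇ a) ≡ (q <ᵇ a)
shiftPos-<ᵇ-a a q with q <ᵇ a in e
... | true  = e
... | false = <ᵇ-false (ℕP.≤-trans (<ᵇ-false⇒≥ {q} {a} e) (ℕP.n≤1+n q))

zigzagChord : ℕ → ℕ × ℕ
zigzagChord p = (2 * p , suc (2 * p))

chord-Z : ∀ i k p → p < k → nthD (0 , 0) (chordsFrom i (Z k)) p ≡ (i + 2 * p , suc (i + 2 * p))
chord-Z i (suc k) zero    lt       = cong (λ z → (z , suc (i + 0))) (sym (ℕP.+-identityʳ i))
chord-Z i (suc k) (suc p) (s≤s lt) = trans (chord-Z (suc (suc i)) k p lt) (cong (λ z → (z , suc z)) (regroup i p))
  where
  regroup : ∀ i p → suc (suc i) + 2 * p ≡ i + 2 * suc p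
  regroup = ℕ-solve

labeledChords-Z : ∀ k σ → IsPerm k σ → labeledChords (Z k) σ ≡ map (λ i → zigzagChord (posOf i σ)) (oneTo k)
labeledChords-Z k σ p =
  trans (cong (λ n → map (λ i → nthD (0 , 0) (chords (Z k)) (posOf i σ)) (map suc (upTo n))) (IsPerm-length p))
    (ListP.map-cong-local (All.tabulate (λ {i} m → chord-Z 0 k (posOf i σ)
      (subst (posOf i σ <_) (IsPerm-length p) (posOf-< (↭P.∈-resp-↭ (↭-sym p) m))))))

count-map : ∀ {A B : Set} (f : B → Bool) (g : A → B) xs → count f (map g xs) ≡ count (f ∘ g) xs
count-map f g []       = refl
count-map f g (z ∷ xs) with f (g z)
... | true  = cong suc (count-map f g xs)
... | false = count-map f g xs

count-cong : ∀ {A : Set} (f g : A → Bool) → (∀ z → f z ≡ g z) → ∀ xs → count f xs ≡ count g xs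
count-cong f g h []       = refl
count-cong f g h (z ∷ xs) with f z | g z | h z
... | true  | true  | _ = cong suc (count-cong f g h xs)
... | false | false | _ = count-cong f g h xs

count-++ : ∀ {A : Set} (f : A → Bool) xs ys → count f (xs ++ ys) ≡ count f xs + count f ys
count-++ f []       ys = refl
count-++ f (z ∷ xs) ys with f z
... | true  = cong suc (count-++ f xs ys)
... | false = count-++ f xs ys

count-all : ∀ {A : Set} (f : A → Bool) xs → All (λ z → f z ≡ true) xs → count f xs ≡ length xs
count-all f []       []      = refl
count-all f (z ∷ xs) (e ∷ a) rewrite e = cong suc (count-all f xs a)

count-none : ∀ {A : Set} (f : A → Bool) xs → All (λ z → f z ≡ false) xs → count f xs ≡ 0
count-none f []       []      = refl
count-none f (z ∷ xs) (e ∷ a) rewrite e = count-none f xs a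

count-↭ : ∀ (f : ℕ → Bool) {xs ys} → xs ↭ ys → count f xs ≡ count f ys
count-↭ f p = ↭P.↭-length (↭P.filter-↭ (T? ∘ f) p)

earlierBelow : List ℕ → ℕ → ℕ
earlierBelow prev p = count (_<ᵇ p) prev

-- The sequence (p_i) of a labeled tree on Z, computed from the chord positions: both counts
-- in p_i equal the number of earlier chords to the left.
zigzagSeq : List ℕ → List ℕ → List ℕ
zigzagSeq prev []       = []
zigzagSeq prev (p ∷ ps) = (earlierBelow prev p + earlierBelow prev p) ∷ zigzagSeq (prev ∷ʳ p) ps

<ᵇ-double : ∀ q p → (2 * q <ᵇ 2 * p) ≡ (q <ᵇ p)
<ᵇ-double q p = <ᵇ-cong-⇔ (ℕP.*-cancelˡ-< 2 q p) (ℕP.*-monoʳ-< 2)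

<ᵇ-double-suc : ∀ q p → (suc (2 * q) <ᵇ 2 * p) ≡ (q <ᵇ p)
<ᵇ-double-suc q p = <ᵇ-cong-⇔ (λ lt → ℕP.*-cancelˡ-< 2 q p (ℕP.<-trans (ℕP.n<1+n _) lt))
  (λ lt → ℕP.<-≤-trans (subst (suc (2 * q) <_) (sym (double-suc q)) (ℕP.n<1+n (suc (2 * q)))) (ℕP.*-monoʳ-≤ 2 lt))

pSeqFrom-zigzag : ∀ prev ps → pSeqFrom (map zigzagChord prev) (map zigzagChord ps) ≡ zigzagSeq prev ps
pSeqFrom-zigzag prev []       = refl
pSeqFrom-zigzag prev (p ∷ ps) = cong₂ _∷_
  (cong₂ _+_ (trans (count-map (λ c → proj₁ c <ᵇ 2 * p) zigzagChord prev) (count-cong _ _ (λ q → <ᵇ-double q p) prev))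
             (trans (count-map (λ c → proj₂ c <ᵇ 2 * p) zigzagChord prev) (count-cong _ _ (λ q → <ᵇ-double-suc q p) prev)))
  (trans (cong (λ z → pSeqFrom z (map zigzagChord ps)) (sym (ListP.map-++ zigzagChord prev (p ∷ [])))) (pSeqFrom-zigzag (prev ∷ʳ p) ps))

zigzagSeq-∷ʳ : ∀ prev ps z → zigzagSeq prev (ps ∷ʳ z) ≡ zigzagSeq prev ps ∷ʳ (earlierBelow (prev ++ ps) z + earlierBelow (prev ++ ps) z)
zigzagSeq-∷ʳ prev []       z = cong (λ l → (earlierBelow l z + earlierBelow l z) ∷ []) (sym (ListP.++-identityʳ prev))
zigzagSeq-∷ʳ prev (p ∷ ps) z = cong (_ ∷_) (trans (zigzagSeq-∷ʳ (prev ∷ʳ p) ps z)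
   (cong (λ l → zigzagSeq (prev ∷ʳ p) ps ∷ʳ (earlierBelow l z + earlierBelow l z)) (ListP.++-assoc prev (p ∷ []) ps)))

zigzagSeq-monotone : ∀ (f : ℕ → ℕ) → (∀ q p → (f q <ᵇ f p) ≡ (q <ᵇ p)) → ∀ prev ps → zigzagSeq (map f prev) (map f ps) ≡ zigzagSeq prev ps
zigzagSeq-monotone f mono prev []       = refl
zigzagSeq-monotone f mono prev (p ∷ ps) = cong₂ _∷_ (cong (λ z → z + z) same-count)
   (trans (cong (λ l → zigzagSeq l (map f ps)) (sym (ListP.map-++ f prev (p ∷ [])))) (zigzagSeq-monotone f mono (prev ∷ʳ p) ps))
  where
  same-count : earlierBelow (map f prev) (f p) ≡ earlierBelow prev p
  same-count = trans (count-map (_<ᵇ f p) f prev) (count-cong _ _ (λ q → mono q p) prev)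

treeSeq-Z : ∀ k σ → IsPerm k σ → treeSeq (Z k) σ ≡ zigzagSeq [] (map (λ i → posOf i σ) (oneTo k))
treeSeq-Z k σ p = trans (cong (pSeqFrom []) (trans (labeledChords-Z k σ p) (ListP.map-∘ (oneTo k))))
  (pSeqFrom-zigzag [] (map (λ i → posOf i σ) (oneTo k)))

∉-left : ∀ (α : List ℕ) {β i} → Unique (α ++ β) → i ∈ β → i ∉ α
∉-left (a ∷ α) (ua ∷ u) mβ (here refl) = All.lookup ua (∈P.∈-++⁺ʳ α mβ) refl
∉-left (a ∷ α) (ua ∷ u) mβ (there m)   = ∉-left α u mβ m

treeSeq-insert-max : ∀ m α β → IsPerm m (α ++ β) →
  treeSeq (Z (suc m)) (α ++ suc m ∷ β) ≡ treeSeq (Z m) (α ++ β) ∷ʳ (length α + length α)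
treeSeq-insert-max m α β pτ = begin
  treeSeq (Z (suc m)) σ                                                ≡⟨ treeSeq-Z (suc m) σ (IsPerm-insert-max m α β pτ) ⟩
  zigzagSeq [] (map (λ i → posOf i σ) (oneTo (suc m)))                 ≡⟨ cong (zigzagSeq []) positions-σ ⟩
  zigzagSeq [] (map (shiftPos a) Pτ ∷ʳ a)                              ≡⟨ zigzagSeq-∷ʳ [] (map (shiftPos a) Pτ) a ⟩
  zigzagSeq [] (map (shiftPos a) Pτ) ∷ʳ (earlierBelow (map (shiftPos a) Pτ) a + earlierBelow (map (shiftPos a) Pτ) a)
                                                                       ≡⟨ cong₂ (λ l c → l ∷ʳ (c + c)) (zigzagSeq-monotone (shiftPos a) (shiftPos-<ᵇ a) [] Pτ) a-earlier ⟩
  zigzagSeq [] Pτ ∷ʳ (a + a)                                           ≡⟨ cong (_∷ʳ (a + a)) (sym (treeSeq-Z m τ pτ)) ⟩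
  treeSeq (Z m) τ ∷ʳ (a + a)                                           ∎
  where
  open ≡-Reasoning
  σ = α ++ suc m ∷ β
  τ = α ++ β
  a = length α
  Pτ = map (λ i → posOf i τ) (oneTo m)
  positions-σ : map (λ i → posOf i σ) (oneTo (suc m)) ≡ map (shiftPos a) Pτ ∷ʳ a
  positions-σ = begin
    map (λ i → posOf i σ) (oneTo (suc m))                              ≡⟨ cong (map (λ i → posOf i σ)) (oneTo-suc m) ⟩
    map (λ i → posOf i σ) (oneTo m ∷ʳ suc m)                           ≡⟨ ListP.map-++ (λ i → posOf i σ) (oneTo m) (suc m ∷ []) ⟩
    map (λ i → posOf i σ) (oneTo m) ∷ʳ posOf (suc m) σ                 ≡⟨ cong₂ _∷ʳ_ shifted (posOf-inserted α (λ mm → ℕP.<-irrefl refl (IsPerm-∈ pτ (∈P.∈-++⁺ˡ mm)))) ⟩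
    map (shiftPos a) Pτ ∷ʳ a                                           ∎
    where
    shifted : map (λ i → posOf i σ) (oneTo m) ≡ map (shiftPos a) Pτ
    shifted = trans (ListP.map-cong-local (All.tabulate (λ {i} mi → posOf-insert α {suc m} {β} {i} (λ e → ℕP.<-irrefl (sym e) (s≤s (∈-oneTo⁻ mi))))))
                (ListP.map-∘ (oneTo m))
  a-earlier : earlierBelow (map (shiftPos a) Pτ) a ≡ a
  a-earlier = begin
    earlierBelow (map (shiftPos a) Pτ) a                               ≡⟨ count-map (_<ᵇ a) (shiftPos a) Pτ ⟩
    count (λ q → shiftPos a q <ᵇ a) Pτ                                 ≡⟨ count-cong _ _ (shiftPos-<ᵇ-a a) Pτ ⟩
    count (_<ᵇ a) Pτ                                                   ≡⟨ count-map (_<ᵇ a) (λ i → posOf i τ) (oneTo m) ⟩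
    count (λ i → posOf i τ <ᵇ a) (oneTo m)                             ≡⟨ count-↭ (λ i → posOf i τ <ᵇ a) (↭-sym pτ) ⟩
    count (λ i → posOf i τ <ᵇ a) τ                                     ≡⟨ count-++ (λ i → posOf i τ <ᵇ a) α β ⟩
    count (λ i → posOf i τ <ᵇ a) α + count (λ i → posOf i τ <ᵇ a) β    ≡⟨ cong₂ _+_ (count-all _ α (All.tabulate in-α)) (count-none _ β (All.tabulate in-β)) ⟩
    a + 0                                                              ≡⟨ ℕP.+-identityʳ a ⟩
    a                                                                  ∎
    where
    in-α : ∀ {i} → i ∈ α → (posOf i τ <ᵇ a) ≡ true
    in-α mi = <ᵇ-true (subst (_< a) (sym (posOf-++-∈ α β mi)) (posOf-< mi))
    in-β : ∀ {i} → i ∈ β → (posOf i τ <ᵇ a) ≡ false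
    in-β mi = <ᵇ-false (subst (a ≤_) (sym (posOf-++-∉ α β (∉-left α (IsPerm-unique pτ) mi))) (ℕP.m≤m+n a _))

-- Growth rules and the bijection

-- A growth rule turns a tiling with upper path A B, for a Dyck prefix A, into one with upper path
-- A U X D, where B ⇝ X is a bijection between Dyck paths.
record GrowthRule (g : ℕ → Tiling → Tiling) : Set₁ where
  field
    _⇝_ : Path → Path → Set
    grow : ∀ k T A B → OneBoxZ k T → upper T ≡ A ++ B → Dyck A → Dyck B →
      Σ Path λ X → B ⇝ X × OneBoxZ (suc k) (g (length A) T) × (upper (g (length A) T) ≡ A ++ true ∷ X ++ false ∷ [])
    ⇝-dyck       : ∀ {B X} → Dyck B → B ⇝ X → Dyck X
    ⇝-length     : ∀ {B X} → B ⇝ X → length X ≡ length B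
    ⇝-functional : ∀ {B X X′} → B ⇝ X → B ⇝ X′ → X ≡ X′
    ⇝-injective  : ∀ {B B′ X} → B ⇝ X → B′ ⇝ X → B ≡ B′
    ⇝-surjective : ∀ X → Dyck X → Σ Path λ B → Dyck B × B ⇝ X

module Bijection (g : ℕ → Tiling → Tiling) (rule : GrowthRule g) where
  open GrowthRule rule

  grown : ℕ → List ℕ → Tiling
  grown m σ = foldl (λ T p → g p T) emptyTiling (treeSeq (Z m) σ)

  DyckSplit : Path → ℕ → Set
  DyckSplit μ s = Σ Path λ A → Σ Path λ B → (μ ≡ A ++ B) × (length A ≡ s) × Dyck A × Dyck B

  -- The Dyck prefixes of the upper path are exactly the cuts σ = α β with α below β.
  SplitsMatch : ℕ → List ℕ → Set
  SplitsMatch m σ = ∀ α β → σ ≡ α ++ β →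
    (Below α β → DyckSplit (upper (grown m σ)) (2 * length α)) × (DyckSplit (upper (grown m σ)) (2 * length α) → Below α β)

  grown-insert-max : ∀ m α β → IsPerm m (α ++ β) → grown (suc m) (α ++ suc m ∷ β) ≡ g (2 * length α) (grown m (α ++ β))
  grown-insert-max m α β p = begin
    foldl (λ T p → g p T) emptyTiling (treeSeq (Z (suc m)) (α ++ suc m ∷ β))  ≡⟨ cong (foldl (λ T p → g p T) emptyTiling) (treeSeq-insert-max m α β p) ⟩
    foldl (λ T p → g p T) emptyTiling (treeSeq (Z m) (α ++ β) ∷ʳ (a + a))     ≡⟨ ListP.foldl-++ (λ T p → g p T) emptyTiling (treeSeq (Z m) (α ++ β)) _ ⟩
    g (a + a) (grown m (α ++ β))                                               ≡⟨ cong (λ s → g s (grown m (α ++ β))) (cong (λ z → a + z) (sym (ℕP.+-identityʳ a))) ⟩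
    g (2 * a) (grown m (α ++ β))                                               ∎
    where
    open ≡-Reasoning
    a = length α

  record Step (m : ℕ) (α β : List ℕ) : Set where
    field
      A₀ B₀ X : Path
      upper≡A₀B₀ : upper (grown m (α ++ β)) ≡ A₀ ++ B₀
      length-A₀ : length A₀ ≡ 2 * length α
      dyck-A₀ : Dyck A₀
      dyck-B₀ : Dyck B₀
      dyck-X : Dyck X
      B₀⇝X : B₀ ⇝ X
      oneBoxZ : OneBoxZ (suc m) (grown (suc m) (α ++ suc m ∷ β))
      upper≡A₀UXD : upper (grown (suc m) (α ++ suc m ∷ β)) ≡ A₀ ++ true ∷ X ++ false ∷ []

  step : ∀ m α β → Perm231 m (α ++ β) → Below α β → OneBoxZ m (grown m (α ++ β)) → SplitsMatch m (α ++ β) → Step m α β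
  step m α β pτ lt Gτ sτ with proj₁ (sτ α β refl) lt
  ... | A₀ , B₀ , eμ , lA , wA , wB with grow m (grown m (α ++ β)) A₀ B₀ Gτ eμ wA wB
  ... | X , rel , G′ , eu = record
    { A₀ = A₀ ; B₀ = B₀ ; X = X ; upper≡A₀B₀ = eμ ; length-A₀ = lA ; dyck-A₀ = wA ; dyck-B₀ = wB
    ; dyck-X = ⇝-dyck wB rel ; B₀⇝X = rel
    ; oneBoxZ = subst (OneBoxZ (suc m)) (sym grown≡) G′ ; upper≡A₀UXD = trans (cong upper grown≡) eu }
    where
    grown≡ : grown (suc m) (α ++ suc m ∷ β) ≡ g (length A₀) (grown m (α ++ β))
    grown≡ = trans (grown-insert-max m α β (proj₁ pτ)) (cong (λ s → g s (grown m (α ++ β))) (sym lA))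

  -- Cuts α′ | β′ of α (m+1) β falling inside α: both sides reduce to the cut α′ | M β of α β.
  cut-before-max : ∀ m α β → Perm231 m (α ++ β) → SplitsMatch m (α ++ β) → (st : Step m α β) → ∀ α′ β′ M →
    α ≡ α′ ++ M → β′ ≡ M ++ suc m ∷ β →
    (Below α′ β′ → DyckSplit (upper (grown (suc m) (α ++ suc m ∷ β))) (2 * length α′)) ×
    (DyckSplit (upper (grown (suc m) (α ++ suc m ∷ β))) (2 * length α′) → Below α′ β′)
  cut-before-max m α β pτ sτ st α′ β′ M refl refl = forward , backward
    where
    open Step st
    τ≡ : (α′ ++ M) ++ β ≡ α′ ++ (M ++ β)
    τ≡ = ListP.++-assoc α′ M β
    prefix≤A₀ : 2 * length α′ ≤ length A₀
    prefix≤A₀ = subst (2 * length α′ ≤_) (sym length-A₀) (ℕP.*-monoʳ-≤ 2 (ListP.length-++-≤ˡ α′))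
    forward : Below α′ (M ++ suc m ∷ β) → DyckSplit (upper (grown (suc m) ((α′ ++ M) ++ suc m ∷ β))) (2 * length α′)
    forward lt′ with proj₁ (sτ α′ (M ++ β) τ≡) (All.map (All-delete M) lt′)
    ... | A′ , B′ , eμ′ , lA′ , wA′ , wB′ with ++-prefix-≤ A′ B′ A₀ B₀ (trans (sym eμ′) upper≡A₀B₀) (subst (_≤ length A₀) (sym lA′) prefix≤A₀)
    ... | N , refl , _ = A′ , N ++ true ∷ X ++ false ∷ [] , trans upper≡A₀UXD (ListP.++-assoc A′ N _) ,
                         lA′ , wA′ , walk-++ (dyck-suffix dyck-A₀ wA′) (prime dyck-X)
    backward : DyckSplit (upper (grown (suc m) ((α′ ++ M) ++ suc m ∷ β))) (2 * length α′) → Below α′ (M ++ suc m ∷ β)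
    backward (A , B , eμ , lA , wA , wB) with ++-prefix-≤ A B A₀ (true ∷ X ++ false ∷ []) (trans (sym eμ) upper≡A₀UXD) (subst (_≤ length A₀) (sym lA) prefix≤A₀)
    ... | N , refl , _ = All.tabulate (λ {a} ma → All-insert M (s≤s (IsPerm-∈ (proj₁ pτ) (subst (a ∈_) (sym τ≡) (∈P.∈-++⁺ˡ ma)))) (All.lookup below ma))
      where
      below : Below α′ (M ++ β)
      below = proj₂ (sτ α′ (M ++ β) τ≡) (A , N ++ B₀ , trans upper≡A₀B₀ (ListP.++-assoc A N B₀) , lA , wA , walk-++ (dyck-suffix dyck-A₀ wA) dyck-B₀)

  -- Cuts α′ | β′ with m+1 ∈ α′: α′ is below β′ only for β′ = [], and the upper path has a Dyck prefix
  -- longer than A₀ only when it is the whole path.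
  cut-after-max : ∀ m α β → Perm231 m (α ++ β) → (st : Step m α β) → ∀ α′ β′ M′ → α ++ suc m ∷ β ≡ α′ ++ β′ → α′ ≡ α ++ suc m ∷ M′ →
    (Below α′ β′ → DyckSplit (upper (grown (suc m) (α ++ suc m ∷ β))) (2 * length α′)) ×
    (DyckSplit (upper (grown (suc m) (α ++ suc m ∷ β))) (2 * length α′) → Below α′ β′)
  cut-after-max m α β pτ st α′ β′ M′ eq refl = forward , backward
    where
    open Step st
    μ = upper (grown (suc m) (α ++ suc m ∷ β))
    pσ : IsPerm (suc m) (α′ ++ β′)
    pσ = subst (IsPerm (suc m)) eq (IsPerm-insert-max m α β (proj₁ pτ))
    forward : Below α′ β′ → DyckSplit μ (2 * length α′)
    forward lt′ = μ , [] , sym (ListP.++-identityʳ μ) , trans (upper-length oneBoxZ) (cong (2 *_) (sym |α′|≡)) , upper-dyck oneBoxZ , stop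
      where
      |α′|≡ : length α′ ≡ suc m
      |α′|≡ = trans (sym (ℕP.+-identityʳ (length α′)))
        (trans (cong (λ l → length α′ + length l) (sym (Below-max α′ β′ pσ (∈P.∈-++⁺ʳ α (here refl)) lt′))) (IsPerm-++-length α′ β′ pσ))
    backward : DyckSplit μ (2 * length α′) → Below α′ β′
    backward (A , B , eμ , lA , wA , _) = subst (Below α′) (sym β′≡[]) (All.tabulate (λ _ → []))
      where
      B≡[] : B ≡ []
      B≡[] = dyck-prefix-past-last-return dyck-A₀ dyck-X wA (trans (sym eμ) upper≡A₀UXD)
        (subst₂ _<_ (sym length-A₀) (sym lA) (ℕP.*-monoʳ-< 2 (subst (length α <_) (sym (ListP.length-++ α)) (ℕP.m<m+n (length α) (s≤s z≤n)))))
      |α′|≡ : length α′ ≡ suc m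
      |α′|≡ = ℕP.*-cancelˡ-≡ (length α′) (suc m) 2
        (trans (sym lA) (trans (cong length (sym (trans (trans eμ (cong (A ++_) B≡[])) (ListP.++-identityʳ A)))) (upper-length oneBoxZ)))
      β′≡[] : β′ ≡ []
      β′≡[] = length≡0 β′ (ℕP.+-cancelˡ-≡ (length α′) _ _ (trans (IsPerm-++-length α′ β′ pσ) (trans (sym |α′|≡) (sym (ℕP.+-identityʳ _)))))

  SplitsMatch-insert-max : ∀ m α β → Perm231 m (α ++ β) → SplitsMatch m (α ++ β) → Step m α β → SplitsMatch (suc m) (α ++ suc m ∷ β)
  SplitsMatch-insert-max m α β pτ sτ st α′ β′ eq with ++-split α′ β′ α (suc m ∷ β) (sym eq)
  ... | inj₁ (M , eα , eβ′) = cut-before-max m α β pτ sτ st α′ β′ M eα eβ′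
  ... | inj₂ ([] , eα′ , eσ) = cut-before-max m α β pτ sτ st α′ β′ [] (trans (sym (trans eα′ (ListP.++-identityʳ α))) (sym (ListP.++-identityʳ α′))) (sym eσ)
  ... | inj₂ (x ∷ M′ , eα′ , eσ) with ListP.∷-injective eσ
  ... | refl , _ = cut-after-max m α β pτ st α′ β′ M′ eq eα′

  invariant : ∀ m σ → Perm231 m σ → OneBoxZ m (grown m σ) × SplitsMatch m σ
  invariant zero σ (p , _) with length≡0 σ (IsPerm-length p)
  ... | refl = OneBoxZ-empty , λ { [] [] refl → (λ _ → [] , [] , refl , refl , stop , stop) , (λ _ → []) }
  invariant (suc m) σ pσ with Perm231-split-max m σ pσ
  ... | α , β , refl , pτ , lt with invariant m (α ++ β) pτ
  ... | Gτ , sτ = Step.oneBoxZ st , SplitsMatch-insert-max m α β pτ sτ st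
    where
    st = step m α β pτ lt Gτ sτ

  step-of : ∀ m α β → Perm231 m (α ++ β) → Below α β → Step m α β
  step-of m α β pτ lt = step m α β pτ lt (proj₁ (invariant m (α ++ β) pτ)) (proj₂ (invariant m (α ++ β) pτ))

  -- The last return of the upper path recovers A₀ and X, hence the position of m+1 and, by induction, the rest.
  grown-injective : ∀ m σ σ′ → Perm231 m σ → Perm231 m σ′ → upper (grown m σ) ≡ upper (grown m σ′) → σ ≡ σ′
  grown-injective zero σ σ′ (p , _) (p′ , _) _ = trans (length≡0 σ (IsPerm-length p)) (sym (length≡0 σ′ (IsPerm-length p′)))
  grown-injective (suc m) σ σ′ pσ pσ′ e with Perm231-split-max m σ pσ | Perm231-split-max m σ′ pσ′
  ... | α , β , refl , pτ , lt | α₂ , β₂ , refl , pτ₂ , lt₂ = cong₂ (λ a b → a ++ suc m ∷ b) (proj₁ same-cut) (proj₂ same-cut)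
    where
    module S₁ = Step (step-of m α β pτ lt)
    module S₂ = Step (step-of m α₂ β₂ pτ₂ lt₂)
    same-return = last-return-unique S₁.dyck-A₀ S₁.dyck-X S₂.dyck-A₀ S₂.dyck-X (trans (sym S₁.upper≡A₀UXD) (trans e S₂.upper≡A₀UXD))
    same-B₀ : S₁.B₀ ≡ S₂.B₀
    same-B₀ = ⇝-injective S₁.B₀⇝X (subst (S₂.B₀ ⇝_) (sym (proj₂ same-return)) S₂.B₀⇝X)
    same-τ : α ++ β ≡ α₂ ++ β₂
    same-τ = grown-injective m (α ++ β) (α₂ ++ β₂) pτ pτ₂
      (trans S₁.upper≡A₀B₀ (trans (cong₂ _++_ (proj₁ same-return) same-B₀) (sym S₂.upper≡A₀B₀)))
    same-cut = ++-cancel-length α β α₂ β₂ same-τ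
      (ℕP.*-cancelˡ-≡ (length α) (length α₂) 2 (trans (sym S₁.length-A₀) (trans (cong length (proj₁ same-return)) S₂.length-A₀)))

  cut-at-dyck-prefix : ∀ m τ A B → Perm231 m τ → upper (grown m τ) ≡ A ++ B → Dyck A → Dyck B →
    Σ (List ℕ) λ α → Σ (List ℕ) λ β → (α ++ β ≡ τ) × (length A ≡ 2 * length α) × Below α β
  cut-at-dyck-prefix m τ A B pτ eτ wA wB = take a τ , drop a τ , αβ≡τ , |A|≡ , below
    where
    a = ups A
    a≤m : a ≤ m
    a≤m = ℕP.*-cancelˡ-≤ 2 (subst (_≤ 2 * m) (dyck-length wA)
            (subst (length A ≤_) (trans (cong length (sym eτ)) (upper-length (proj₁ (invariant m τ pτ)))) (ListP.length-++-≤ˡ A)))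
    αβ≡τ : take a τ ++ drop a τ ≡ τ
    αβ≡τ = ListP.take++drop≡id a τ
    |A|≡ : length A ≡ 2 * length (take a τ)
    |A|≡ = trans (dyck-length wA) (cong (2 *_) (sym (trans (ListP.length-take a τ)
             (ℕP.m≤n⇒m⊓n≡m (subst (a ≤_) (sym (IsPerm-length (proj₁ pτ))) a≤m)))))
    below : Below (take a τ) (drop a τ)
    below = proj₂ (proj₂ (invariant m (take a τ ++ drop a τ) (subst (Perm231 m) (sym αβ≡τ) pτ)) _ _ refl)
              (A , B , trans (cong (upper ∘ grown m) αβ≡τ) eτ , |A|≡ , wA , wB)

  grown-surjective : ∀ m μ → Dyck μ → length μ ≡ 2 * m → Σ (List ℕ) λ σ → Perm231 m σ × (upper (grown m σ) ≡ μ)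
  grown-surjective zero μ _ l with length≡0 μ l
  ... | refl = [] , (↭-refl , λ ()) , refl
  grown-surjective (suc m) μ w l with last-return w (λ { refl → 0≢2+ l })
    where
    0≢2+ : 0 ≢ 2 * suc m
    0≢2+ ()
  ... | A , X , refl , wA , wX with ⇝-surjective X wX
  ... | B , wB , B⇝X with grown-surjective m (A ++ B) (walk-++ wA wB) |AB|
    where
    |AB| : length (A ++ B) ≡ 2 * m
    |AB| = ℕP.suc-injective (ℕP.suc-injective (begin
      2 + length (A ++ B)                  ≡⟨ cong (λ n → 2 + n) (ListP.length-++ A) ⟩
      2 + length A + length B              ≡⟨ cong (λ n → 2 + length A + n) (sym (⇝-length B⇝X)) ⟩
      2 + length A + length X              ≡⟨ sym (length-last-return A X) ⟩
      length (A ++ true ∷ X ++ false ∷ []) ≡⟨ trans l (double-suc m) ⟩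
      2 + 2 * m                            ∎))
      where open ≡-Reasoning
  ... | τ , pτ , eτ with cut-at-dyck-prefix m τ A B pτ eτ wA wB
  ... | α , β , refl , |A|≡ , below = α ++ suc m ∷ β , Perm231-insert-max m α β pτ below , upper≡
    where
    module S = Step (step-of m α β pτ below)
    same-cut = ++-cancel-length S.A₀ S.B₀ A B (trans (sym S.upper≡A₀B₀) eτ) (trans S.length-A₀ (sym |A|≡))
    upper≡ : upper (grown (suc m) (α ++ suc m ∷ β)) ≡ A ++ true ∷ X ++ false ∷ []
    upper≡ = trans S.upper≡A₀UXD (cong₂ (λ p q → p ++ true ∷ q ++ false ∷ []) (proj₁ same-cut)
               (⇝-functional (subst (_⇝ S.X) (proj₂ same-cut) S.B₀⇝X) B⇝X))

  grown-bijection : ∀ n → RestrictsToBijection (grown n) (Perm231 n) (OneBoxZTiling n) _≈T_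
  grown-bijection n =
    (λ σ p → OneBoxZ⇒OneBoxZTiling n (grown n σ) (proj₁ (invariant n σ p))) ,
    (λ σ σ′ p p′ e → grown-injective n σ σ′ p p′ (proj₁ (proj₂ e))) ,
    onto
    where
    onto : ∀ T → OneBoxZTiling n T → Σ (List ℕ) λ σ → Perm231 n σ × (grown n σ ≈T T)
    onto T ob with OneBoxZTiling⇒OneBoxZ n T ob
    ... | G with grown-surjective n (upper T) (upper-dyck G) (upper-length G)
    ... | σ , p , e = σ , p , OneBoxZ-≈ n (grown n σ) T (proj₁ (invariant n σ p)) G e

stripRule : GrowthRule stripGrow
stripRule = record
  { _⇝_ = λ B X → X ≡ B
  ; grow = λ k T A B G e wA _ → B , refl , stripGrow-OneBoxZ k T A B G e wA
  ; ⇝-dyck = λ { wB refl → wB }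
  ; ⇝-length = λ { refl → refl }
  ; ⇝-functional = λ { refl refl → refl }
  ; ⇝-injective = λ { refl refl → refl }
  ; ⇝-surjective = λ X w → X , w , refl }

-- The bijection on Dyck paths performed by ribbon-grow: [] ↦ [] and B′ U C D ↦ U B′ D C.
data _⇝ʳ_ (B X : Path) : Set where
  empty  : B ≡ [] → X ≡ [] → B ⇝ʳ X
  rotate : ∀ B′ C → Dyck B′ → Dyck C → B ≡ B′ ++ true ∷ C ++ false ∷ [] → X ≡ true ∷ B′ ++ false ∷ C → B ⇝ʳ X

ribbonGrow-OneBoxZ : ∀ k T A B → OneBoxZ k T → upper T ≡ A ++ B → Dyck A → Dyck B →
  Σ Path λ X → B ⇝ʳ X × OneBoxZ (suc k) (ribbonGrow (length A) T) × (upper (ribbonGrow (length A) T) ≡ A ++ true ∷ X ++ false ∷ [])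
ribbonGrow-OneBoxZ k T A [] G e wA _ with ribbonGrow-OneBoxZ-[] k T A G e wA
... | G′ , eu = [] , empty refl refl , G′ , eu
ribbonGrow-OneBoxZ k T A (b ∷ B) G e wA wB with last-return wB (λ ())
... | B′ , C , eB , wB′ , wC with ribbonGrow-OneBoxZ-∷ k T A B′ C G (trans e (cong (A ++_) eB)) wA wB′ wC
... | G′ , eu = true ∷ B′ ++ false ∷ C , rotate B′ C wB′ wC eB refl , G′ ,
      trans eu (cong (λ z → A ++ true ∷ true ∷ z) (sym (ListP.++-assoc B′ (false ∷ C) (false ∷ []))))

⇝ʳ-dyck : ∀ {B X} → B ⇝ʳ X → Dyck X
⇝ʳ-dyck (empty _ refl)               = stop
⇝ʳ-dyck (rotate _ _ wB′ wC _ refl) = up (walk-++ (walk-lift wB′) (down wC))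

⇝ʳ-length : ∀ {B X} → B ⇝ʳ X → length X ≡ length B
⇝ʳ-length (empty refl refl) = refl
⇝ʳ-length (rotate B′ C _ _ refl refl) = begin
  suc (length (B′ ++ false ∷ C))             ≡⟨ cong suc (ListP.length-++ B′) ⟩
  suc (length B′ + suc (length C))           ≡⟨ regroup (length B′) (length C) ⟩
  length B′ + suc (length C + 1)             ≡⟨ sym (cong (λ z → length B′ + suc z) (ListP.length-++ C)) ⟩
  length B′ + suc (length (C ++ false ∷ [])) ≡⟨ sym (ListP.length-++ B′) ⟩
  length (B′ ++ true ∷ C ++ false ∷ [])      ∎
  where
  open ≡-Reasoning
  regroup : ∀ b c → suc (b + suc c) ≡ b + suc (c + 1)
  regroup = ℕ-solve

[]≢last-return : ∀ B′ {C : Path} → [] ≢ B′ ++ true ∷ C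
[]≢last-return B′ e with ListP.++-conicalʳ B′ _ (sym e)
... | ()

⇝ʳ-functional : ∀ {B X X′} → B ⇝ʳ X → B ⇝ʳ X′ → X ≡ X′
⇝ʳ-functional (empty _ refl) (empty _ refl) = refl
⇝ʳ-functional (empty refl _) (rotate B′ _ _ _ e _) = ⊥-elim ([]≢last-return B′ e)
⇝ʳ-functional (rotate B′ _ _ _ e _) (empty refl _) = ⊥-elim ([]≢last-return B′ e)
⇝ʳ-functional (rotate _ _ w₁ v₁ e₁ refl) (rotate _ _ w₂ v₂ e₂ refl) with last-return-unique w₁ v₁ w₂ v₂ (trans (sym e₁) e₂)
... | refl , refl = refl

⇝ʳ-injective : ∀ {B B′ X} → B ⇝ʳ X → B′ ⇝ʳ X → B ≡ B′
⇝ʳ-injective (empty refl _) (empty refl _) = refl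
⇝ʳ-injective (empty _ refl) (rotate _ _ _ _ _ ())
⇝ʳ-injective (rotate _ _ _ _ _ refl) (empty _ ())
⇝ʳ-injective (rotate _ _ w₁ v₁ refl refl) (rotate _ _ w₂ v₂ refl e) with first-return-unique w₁ w₂ (proj₂ (ListP.∷-injective e))
... | refl , refl = refl

⇝ʳ-surjective : ∀ X → Dyck X → Σ Path λ B → Dyck B × B ⇝ʳ X
⇝ʳ-surjective [] _ = [] , stop , empty refl refl
⇝ʳ-surjective (true ∷ X) w with first-return w
... | P , R , e , wP , wR = P ++ true ∷ R ++ false ∷ [] , walk-++ wP (prime wR) , rotate P R wP wR refl (cong (true ∷_) e)

ribbonRule : GrowthRule ribbonGrow
ribbonRule = record
  { _⇝_ = _⇝ʳ_ ; grow = ribbonGrow-OneBoxZ ; ⇝-dyck = λ _ → ⇝ʳ-dyck ; ⇝-length = ⇝ʳ-length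
  ; ⇝-functional = ⇝ʳ-functional ; ⇝-injective = ⇝ʳ-injective ; ⇝-surjective = ⇝ʳ-surjective }

theorem9 : ∀ (n : ℕ) →
    RestrictsToBijection (DTS (Z n)) (Perm231 n) (OneBoxZTiling n) _≈T_ ×
    RestrictsToBijection (DTR (Z n)) (Perm231 n) (OneBoxZTiling n) _≈T_
theorem9 n = Bijection.grown-bijection stripGrow stripRule n , Bijection.grown-bijection ribbonGrow ribbonRule n
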